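{- Let $r\in\mathbb{N}$, $t\in\mathbb{N}_0$, and let $a_j,b_j\in\mathbb{N}_0$ and integers $c_j\ge3$ for all $j\ge1$. Then for every $n\in\mathbb{N}$: (i) If $\mathbf{s}=(\{2\}^{a_1},1,\{2\}^{b_1},c_1,\{2\}^{a_2},1,\{2\}^{b_2},c_2,\dots,\{2\}^{a_r},1,\{2\}^{b_r},c_r,\{2\}^t)$, then \[H^\star_n(\mathbf{s})=-\sum_{\mathbf{p}\in\Pi(2a_1+1,\overline{2b_1+2},\{1\}^{c_1-3},\overline{2a_2+2},\overline{2b_2+2},\{1\}^{c_2-3},\dots,\overline{2a_r+2},\overline{2b_r+2},\{1\}^{c_r-3},2t+1)}2^{\ell(\mathbf{p})}\mathcal{H}_n(\mathbf{p}).\] (ii) If $\mathbf{s}=(\{2\}^{b_1},c_1,\{2\}^{a_1},1,\dots,\{2\}^{b_r},c_r,\{2\}^{a_r},1,\{2\}^{b_{r+1}},c_{r+1},\{2\}^t)$, then \[H^\star_n(\mathbf{s})=-\sum_{\mathbf{p}\in\Pi(\overline{2b_1+2},\{1\}^{c_1-3},\overline{2a_1+2},\dots,\overline{2b_r+2},\{1\}^{c_r-3},\overline{2a_r+2},\overline{2b_{r+1}+2},\{1\}^{c_{r+1}-3},2t+1)}2^{\ell(\mathbf{p})}\mathcal{H}_n(\mathbf{p}).\]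
   Context: $\mathbb{N}=\{1,2,\dots\}$, $\mathbb{N}_0=\mathbb{N}\cup\{0\}$; for a positive integer $m$, $\overline{m}$ denotes $-m$. $\{x\}^a$ denotes $a$ consecutive copies of $x$. For $\mathbf{s}=(s_1,\dots,s_\ell)$ with nonzero integer entries, $H_n(\mathbf{s})=\sum_{n\ge k_1>\cdots>k_\ell\ge1}\prod_{i=1}^\ell \frac{\operatorname{sgn}(s_i)^{k_i}}{k_i^{|s_i|}}$ and $H^\star_n(\mathbf{s})=\sum_{n\ge k_1\ge\cdots\ge k_\ell\ge1}\prod_{i=1}^\ell \frac{\operatorname{sgn}(s_i)^{k_i}}{k_i^{|s_i|}}$, with $H_n(\mathbf{s})=0$ if $n<\ell$ and $H_n(\emptyset)=H^\star_n(\emptyset)=1$. For nonzero integers $a,b$, $a\oplus b=\operatorname{sgn}(a)b+\operatorname{sgn}(b)a$. For a sequence $(s_1,\dots,s_m)$ of nonzero integers, $\Pi(s_1,\dots,s_m)$ is the set of the $2^{m-1}$ indices $s_1\circ\cdots\circ s_m$ where each $\circ$ is independently "," or $\oplus$ (entries joined by $\oplus$ merge into one component); $\ell(\mathbf{p})$ is the number of components. For $\mathbf{p}=(p_1,\dots,p_m)$, $\mathcal{H}_n(\mathbf{p})=\sum_{k=1}^n\frac{\operatorname{sgn}(p_1)^k}{k^{|p_1|}}\frac{\binom{n}{k}}{\binom{n+k}{k}}H_{k-1}(p_2,\dots,p_m)$. -}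

module Defs where

open import Data.Nat as ℕ using (ℕ; zero; suc; _∸_; _≡ᵇ_)
open import Data.Nat.Combinatorics using (_C_)
open import Data.Integer as ℤ using (ℤ; +_; -[1+_]; +[1+_])
open import Data.Rational as ℚ using (ℚ; _/_)
open import Data.List using (List; []; _∷_; _++_; map; replicate; length; concat)
open import Data.Bool using (if_then_else_)

sgnℤ : ℤ → ℤ
sgnℤ (+ zero) = + 0
sgnℤ +[1+ n ] = + 1
sgnℤ -[1+ n ] = -[1+ 0 ]

bar : ℕ → ℤ
bar m = ℤ.- (+ m)

_⊕_ : ℤ → ℤ → ℤ
a ⊕ b = sgnℤ a ℤ.* b ℤ.+ sgnℤ b ℤ.* a

-- z / d as a rational, for d ≥ 1 (the value at d = 0 is a junk 0, never used)
frac : ℤ → ℕ → ℚ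
frac z zero = ℚ.0ℚ
frac z (suc d) = z / suc d

sumTo : ℕ → (ℕ → ℚ) → ℚ
sumTo zero f = ℚ.0ℚ
sumTo (suc n) f = sumTo n f ℚ.+ f (suc n)

term : ℤ → ℕ → ℚ
term s k = frac (sgnℤ s ℤ.^ k) (k ℕ.^ ℤ.∣ s ∣)

-- H_n(s) = Σ_{n ≥ k1 > ... > kℓ ≥ 1} Π sgn(s_i)^{k_i} / k_i^{|s_i|}
H : ℕ → List ℤ → ℚ
H n [] = ℚ.1ℚ
H n (s ∷ ss) = sumTo n (λ k → term s k ℚ.* H (k ∸ 1) ss)

-- H*_n(s) = Σ_{n ≥ k1 ≥ ... ≥ kℓ ≥ 1} Π sgn(s_i)^{k_i} / k_i^{|s_i|}
Hstar : ℕ → List ℤ → ℚ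
Hstar n [] = ℚ.1ℚ
Hstar n (s ∷ ss) = sumTo n (λ k → term s k ℚ.* Hstar k ss)

-- 𝓗_n(p1,...,pm) = Σ_{k=1}^n sgn(p1)^k/k^{|p1|} · C(n,k)/C(n+k,k) · H_{k-1}(p2,...,pm)
-- (empty index: junk value 0; never used since Π of a nonempty list has no empty member)
calH : ℕ → List ℤ → ℚ
calH n [] = ℚ.0ℚ
calH n (p ∷ ps) =
  sumTo n (λ k → term p k ℚ.* frac (+ (n C k)) ((n ℕ.+ k) C k) ℚ.* H (k ∸ 1) ps)

-- Π(s1,...,sm): all 2^{m-1} ways of choosing each ∘ as "," or ⊕
mergeHead : ℤ → List ℤ → List ℤ
mergeHead s [] = s ∷ []
mergeHead s (p ∷ ps) = (s ⊕ p) ∷ ps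

Π : List ℤ → List (List ℤ)
Π [] = [] ∷ []
Π (s ∷ []) = (s ∷ []) ∷ []
Π (s ∷ s' ∷ ss) = map (s ∷_) (Π (s' ∷ ss)) ++ map (mergeHead s) (Π (s' ∷ ss))

sumΠ : ℕ → List ℤ → ℚ
sumΠ n ps = go (Π ps)
  where
  go : List (List ℤ) → ℚ
  go [] = ℚ.0ℚ
  go (p ∷ pp) = frac (+ (2 ℕ.^ length p)) 1 ℚ.* calH n p ℚ.+ go pp

blocks : ℕ → (ℕ → List ℤ) → List ℤ
blocks zero f = []
blocks (suc r) f = blocks r f ++ f (suc r)

twos : ℕ → List ℤ
twos a = replicate a (+ 2)

ones : ℕ → List ℤ
ones a = replicate a (+ 1)

sI : ℕ → ℕ → (ℕ → ℕ) → (ℕ → ℕ) → (ℕ → ℕ) → List ℤ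
sI r t a b c = blocks r (λ j → twos (a j) ++ (+ 1) ∷ twos (b j) ++ (+ c j) ∷ []) ++ twos t

πI : ℕ → ℕ → (ℕ → ℕ) → (ℕ → ℕ) → (ℕ → ℕ) → List ℤ
πI r t a b c =
  blocks r (λ j → (if j ≡ᵇ 1 then + (2 ℕ.* a j ℕ.+ 1) else bar (2 ℕ.* a j ℕ.+ 2))
                  ∷ bar (2 ℕ.* b j ℕ.+ 2) ∷ ones (c j ∸ 3))
  ++ (+ (2 ℕ.* t ℕ.+ 1)) ∷ []

sII : ℕ → ℕ → (ℕ → ℕ) → (ℕ → ℕ) → (ℕ → ℕ) → List ℤ
sII r t a b c =
  blocks r (λ j → twos (b j) ++ (+ c j) ∷ twos (a j) ++ (+ 1) ∷ [])
  ++ twos (b (suc r)) ++ (+ c (suc r)) ∷ twos t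

πII : ℕ → ℕ → (ℕ → ℕ) → (ℕ → ℕ) → (ℕ → ℕ) → List ℤ
πII r t a b c =
  blocks r (λ j → bar (2 ℕ.* b j ℕ.+ 2) ∷ ones (c j ∸ 3) ++ bar (2 ℕ.* a j ℕ.+ 2) ∷ [])
  ++ bar (2 ℕ.* b (suc r) ℕ.+ 2) ∷ ones (c (suc r) ∸ 3) ++ (+ (2 ℕ.* t ℕ.+ 1)) ∷ []

{-# OPTIONS --safe #-}
-- Write 𝕋_N f = Σ_{k=1}^N w(N,k) f(k) with w(N,k) = C(N,k)/C(N+k,k). Splitting Π(x, R) according to
-- whether the first ∘ is "," or ⊕, and using that sgn(p)^k/k^|p| is multiplicative for ⊕, the sum
-- Σ_p 2^ℓ(p) 𝓗_n(p) becomes 𝕋_n(K_Q), where K_(x,R)(k) = sgn(x)^k k^-|x| · Λ K_R(k) with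
-- Λ g(k) = g(k) + 2 Σ_{i<k} g(i) (and 2 in place of Λ K_R when R is empty).
-- On the other side H⋆_n(s, S) = Σ_{m≤n} m^-s H⋆_m(S), and for s = 2, 1 and 3 + j the sum
-- Σ_{m≤n} m^-s 𝕋_m f is again a transform, of k^-2 f, k^-1 Λ f and (-1)^k k^-2 Λ(k^-1 Λ(⋯((-1)^k k^-1 f)))
-- respectively. Telescoping in n reduces each of these to an identity for 𝕋_N alone, proved by Abel
-- summation from (N+k+1) w(N,k+1) = (N-k) w(N,k) and (N+1)² w(N,k) = ((N+1)² - k²) w(N+1,k).
-- Starting from H⋆_n({2}^t) = -𝕋_n(2 (-1)^k k^-2t) and reading s from right to left, every run of 2's,
-- every 1 and every c_j turns the kernel into the kernel of the next index of the claimed list.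
module Submission where

open import Defs
open import Data.Bool using (if_then_else_)
open import Data.Empty using (⊥-elim)
open import Data.Integer as ℤ using (ℤ; +_; -[1+_]; +[1+_])
import Data.Integer.Properties as ℤP
import Data.Integer.Tactic.RingSolver as ℤRing
open import Data.List using (List; []; _∷_; _++_; map; length)
import Data.List.Properties as ListP
open import Data.List.Relation.Unary.All as All using (All; []; _∷_)
open import Data.List.Relation.Unary.All.Properties using (++⁺; map⁺)
open import Data.Nat as ℕ using (ℕ; zero; suc; _∸_; _≤_; _<_; s≤s; z≤n; z<s; NonZero; _!)
open import Data.Nat.Combinatorics using (_C_; k>n⇒nCk≡0; nCk≡n!/k![n-k]!; k![n∸k]!∣n!)
open import Data.Nat.DivMod using (m/n*n≡m)
import Data.Nat.Properties as ℕP
import Data.Nat.Tactic.RingSolver as ℕRing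
open import Data.Product using (_×_; _,_)
open import Data.Rational as ℚ using (ℚ; 0ℚ; 1ℚ; _+_; _*_; -_; _-_; fromℚᵘ)
import Data.Rational.Properties as ℚP
open import Data.Rational.Unnormalised as ℚᵘ using (mkℚᵘ; *≡*)
import Data.Rational.Unnormalised.Properties as ℚᵘP
open import Level using (0ℓ)
open import Relation.Binary.PropositionalEquality
open import Relation.Nullary using (yes; no)
open import Relation.Nullary.Decidable.Core using (dec⇒maybe)
open import Tactic.RingSolver using (solve-∀)
import Tactic.RingSolver.Core.AlmostCommutativeRing as ACR

open ≡-Reasoning

ℚ-ring : ACR.AlmostCommutativeRing 0ℓ 0ℓ
ℚ-ring = ACR.fromCommutativeRing ℚP.+-*-commutativeRing (λ x → dec⇒maybe (0ℚ ℚP.≟ x))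

fromℚᵘ-homo-* : ∀ p q → fromℚᵘ (p ℚᵘ.* q) ≡ fromℚᵘ p * fromℚᵘ q
fromℚᵘ-homo-* p q = ℚP.toℚᵘ-injective (ℚᵘP.≃-trans (ℚP.toℚᵘ-fromℚᵘ (p ℚᵘ.* q))
  (ℚᵘP.≃-sym (ℚᵘP.≃-trans (ℚP.toℚᵘ-homo-* (fromℚᵘ p) (fromℚᵘ q))
    (ℚᵘP.*-cong (ℚP.toℚᵘ-fromℚᵘ p) (ℚP.toℚᵘ-fromℚᵘ q)))))

fromℚᵘ-homo-+ : ∀ p q → fromℚᵘ (p ℚᵘ.+ q) ≡ fromℚᵘ p + fromℚᵘ q
fromℚᵘ-homo-+ p q = ℚP.toℚᵘ-injective (ℚᵘP.≃-trans (ℚP.toℚᵘ-fromℚᵘ (p ℚᵘ.+ q))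
  (ℚᵘP.≃-sym (ℚᵘP.≃-trans (ℚP.toℚᵘ-homo-+ (fromℚᵘ p) (fromℚᵘ q))
    (ℚᵘP.+-cong (ℚP.toℚᵘ-fromℚᵘ p) (ℚP.toℚᵘ-fromℚᵘ q)))))

frac-* : ∀ a b {d e} → 0 < d → 0 < e → frac a d * frac b e ≡ frac (a ℤ.* b) (d ℕ.* e)
frac-* a b {suc d} {suc e} _ _ = sym (fromℚᵘ-homo-* (mkℚᵘ a d) (mkℚᵘ b e))

frac-cross : ∀ a b d e → 0 < d → 0 < e → a ℕ.* e ≡ b ℕ.* d → frac (+ a) d ≡ frac (+ b) e
frac-cross a b (suc d) (suc e) _ _ eq = ℚP.fromℚᵘ-cong {mkℚᵘ (+ a) d} {mkℚᵘ (+ b) e}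
  (*≡* (trans (sym (ℤP.pos-* a (suc e))) (trans (cong +_ eq) (ℤP.pos-* b (suc d)))))

ιℤ : ℤ → ℚ
ιℤ z = frac z 1

ι : ℕ → ℚ
ι n = ιℤ (+ n)

recip : ℕ → ℚ
recip d = frac (+ 1) d

ιℤ-* : ∀ a b → ιℤ (a ℤ.* b) ≡ ιℤ a * ιℤ b
ιℤ-* a b = sym (frac-* a b z<s z<s)

ιℤ-+ : ∀ a b → ιℤ (a ℤ.+ b) ≡ ιℤ a + ιℤ b
ιℤ-+ a b = trans (cong ιℤ (cong₂ ℤ._+_ (sym (ℤP.*-identityʳ a)) (sym (ℤP.*-identityʳ b))))
                 (fromℚᵘ-homo-+ (mkℚᵘ a 0) (mkℚᵘ b 0))

x+y≡z⇒x≡z-y : ∀ {x y z} → x + y ≡ z → x ≡ z - y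
x+y≡z⇒x≡z-y {x} {y} {z} x+y≡z = trans (x≡x+y-y x y) (cong (_- y) x+y≡z)
  where
  x≡x+y-y : ∀ x y → x ≡ x + y - y
  x≡x+y-y = solve-∀ ℚ-ring

ιℤ-neg : ∀ a → ιℤ (ℤ.- a) ≡ - ιℤ a
ιℤ-neg a = begin
  ιℤ (ℤ.- a)            ≡⟨ x+y≡z⇒x≡z-y (sym (ιℤ-+ (ℤ.- a) a)) ⟩
  ιℤ (ℤ.- a ℤ.+ a) - ιℤ a  ≡⟨ cong (λ z → ιℤ z - ιℤ a) (ℤP.+-inverseˡ a) ⟩
  0ℚ - ιℤ a             ≡⟨ ℚP.+-identityˡ (- ιℤ a) ⟩
  - ιℤ a                ∎

ι-+ : ∀ m n → ι (m ℕ.+ n) ≡ ι m + ι n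
ι-+ m n = trans (cong ιℤ (ℤP.pos-+ m n)) (ιℤ-+ (+ m) (+ n))

ι-* : ∀ m n → ι (m ℕ.* n) ≡ ι m * ι n
ι-* m n = trans (cong ιℤ (ℤP.pos-* m n)) (ιℤ-* (+ m) (+ n))

ι-∸ : ∀ {m n} → n ≤ m → ι (m ∸ n) ≡ ι m - ι n
ι-∸ {m} {n} n≤m = x+y≡z⇒x≡z-y (trans (sym (ι-+ (m ∸ n) n)) (cong ι (ℕP.m∸n+n≡m n≤m)))

ι*frac : ∀ n a {d} → 0 < d → ι n * frac (+ a) d ≡ frac (+ (n ℕ.* a)) d
ι*frac n a {d} 0<d = begin
  ι n * frac (+ a) d               ≡⟨ frac-* (+ n) (+ a) z<s 0<d ⟩
  frac (+ n ℤ.* + a) (1 ℕ.* d)     ≡⟨ cong₂ frac (sym (ℤP.pos-* n a)) (ℕP.*-identityˡ d) ⟩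
  frac (+ (n ℕ.* a)) d             ∎

frac≡ιℤ*recip : ∀ z {d} → 0 < d → frac z d ≡ ιℤ z * recip d
frac≡ιℤ*recip z {d} 0<d = sym (begin
  ιℤ z * recip d              ≡⟨ frac-* z (+ 1) z<s 0<d ⟩
  frac (z ℤ.* + 1) (1 ℕ.* d)  ≡⟨ cong₂ frac (ℤP.*-identityʳ z) (ℕP.*-identityˡ d) ⟩
  frac z d                    ∎)

recip-inverse : ∀ d → 0 < d → recip d * ι d ≡ 1ℚ
recip-inverse d 0<d = begin
  recip d * ι d          ≡⟨ ℚP.*-comm (recip d) (ι d) ⟩
  ι d * recip d          ≡⟨ ι*frac d 1 0<d ⟩
  frac (+ (d ℕ.* 1)) d   ≡⟨ frac-cross (d ℕ.* 1) 1 d 1 0<d z<s (d*1*1≡1*d d) ⟩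
  1ℚ                     ∎
  where
  d*1*1≡1*d : ∀ d → d ℕ.* 1 ℕ.* 1 ≡ 1 ℕ.* d
  d*1*1≡1*d = ℕRing.solve-∀

*-cancelˡ-by-inverse : ∀ {r i x y} → r * i ≡ 1ℚ → i * x ≡ i * y → x ≡ y
*-cancelˡ-by-inverse {r} {i} {x} {y} ri≡1 eq = begin
  x              ≡⟨ sym (ℚP.*-identityˡ x) ⟩
  1ℚ * x         ≡⟨ cong (_* x) (sym ri≡1) ⟩
  r * i * x      ≡⟨ ℚP.*-assoc r i x ⟩
  r * (i * x)    ≡⟨ cong (r *_) eq ⟩
  r * (i * y)    ≡⟨ sym (ℚP.*-assoc r i y) ⟩
  r * i * y      ≡⟨ cong (_* y) ri≡1 ⟩
  1ℚ * y         ≡⟨ ℚP.*-identityˡ y ⟩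
  y              ∎

ι-suc-cancel : ∀ n {x y} → ι (suc n) * x ≡ ι (suc n) * y → x ≡ y
ι-suc-cancel n = *-cancelˡ-by-inverse {recip (suc n)} {ι (suc n)} (recip-inverse (suc n) z<s)

≡-modulo : ∀ {E₁ E₂ p q} c → p ≡ q → E₁ ≡ E₂ + c * (p - q) → E₁ ≡ E₂
≡-modulo {E₁} {E₂} {p} {q} c p≡q E₁≡ = begin
  E₁                  ≡⟨ E₁≡ ⟩
  E₂ + c * (p - q)    ≡⟨ cong (λ x → E₂ + c * (x - q)) p≡q ⟩
  E₂ + c * (q - q)    ≡⟨ vanish E₂ c q ⟩
  E₂                  ∎
  where
  vanish : ∀ e c q → e + c * (q - q) ≡ e
  vanish = solve-∀ ℚ-ring

≡-modulo₂ : ∀ {E₁ E₂ p₁ q₁ p₂ q₂} c₁ c₂ → p₁ ≡ q₁ → p₂ ≡ q₂ →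
            E₁ ≡ E₂ + c₁ * (p₁ - q₁) + c₂ * (p₂ - q₂) → E₁ ≡ E₂
≡-modulo₂ {E₁} {E₂} {p₁} {q₁} {p₂} {q₂} c₁ c₂ p₁≡q₁ p₂≡q₂ E₁≡ = begin
  E₁                                        ≡⟨ E₁≡ ⟩
  E₂ + c₁ * (p₁ - q₁) + c₂ * (p₂ - q₂)      ≡⟨ cong₂ (λ x y → E₂ + c₁ * (x - q₁) + c₂ * (y - q₂)) p₁≡q₁ p₂≡q₂ ⟩
  E₂ + c₁ * (q₁ - q₁) + c₂ * (q₂ - q₂)      ≡⟨ vanish E₂ c₁ q₁ c₂ q₂ ⟩
  E₂                                        ∎
  where
  vanish : ∀ e c₁ q₁ c₂ q₂ → e + c₁ * (q₁ - q₁) + c₂ * (q₂ - q₂) ≡ e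
  vanish = solve-∀ ℚ-ring

ι-suc : ∀ n → ι (suc n) ≡ 1ℚ + ι n
ι-suc n = ι-+ 1 n

ι-suc-+ : ∀ m n → ι (suc (m ℕ.+ n)) ≡ 1ℚ + ι m + ι n
ι-suc-+ m n = trans (ι-+ 1 (m ℕ.+ n)) (trans (cong (λ x → 1ℚ + x) (ι-+ m n)) (sym (ℚP.+-assoc 1ℚ (ι m) (ι n))))

recip*ι-cancel : ∀ k x → recip (suc k) * (ι (suc k) * x) ≡ x
recip*ι-cancel k x = begin
  recip (suc k) * (ι (suc k) * x)   ≡⟨ sym (ℚP.*-assoc (recip (suc k)) (ι (suc k)) x) ⟩
  recip (suc k) * ι (suc k) * x     ≡⟨ cong (_* x) (recip-inverse (suc k) z<s) ⟩
  1ℚ * x                            ≡⟨ ℚP.*-identityˡ x ⟩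
  x                                 ∎

ι*recip-cancel : ∀ k x → ι (suc k) * (recip (suc k) * x) ≡ x
ι*recip-cancel k x = trans (rotate (ι (suc k)) (recip (suc k)) x) (recip*ι-cancel k x)
  where
  rotate : ∀ i r x → i * (r * x) ≡ r * (i * x)
  rotate = solve-∀ ℚ-ring

ι²-suc-cancel : ∀ n {x y} → ι (suc n) * ι (suc n) * x ≡ ι (suc n) * ι (suc n) * y → x ≡ y
ι²-suc-cancel n {x} {y} eq = ι-suc-cancel n (ι-suc-cancel n (begin
  ι (suc n) * (ι (suc n) * x)   ≡⟨ sym (ℚP.*-assoc (ι (suc n)) (ι (suc n)) x) ⟩
  ι (suc n) * ι (suc n) * x     ≡⟨ eq ⟩
  ι (suc n) * ι (suc n) * y     ≡⟨ ℚP.*-assoc (ι (suc n)) (ι (suc n)) y ⟩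
  ι (suc n) * (ι (suc n) * y)   ∎))

pow : ℚ → ℕ → ℚ
pow x zero    = 1ℚ
pow x (suc m) = x * pow x m

pow-+ : ∀ x m n → pow x (m ℕ.+ n) ≡ pow x m * pow x n
pow-+ x zero    n = sym (ℚP.*-identityˡ (pow x n))
pow-+ x (suc m) n = trans (cong (x *_) (pow-+ x m n)) (sym (ℚP.*-assoc x (pow x m) (pow x n)))

recip-* : ∀ d e → 0 < d → 0 < e → recip (d ℕ.* e) ≡ recip d * recip e
recip-* d e 0<d 0<e = sym (frac-* (+ 1) (+ 1) 0<d 0<e)

recip-pow : ∀ d m → recip (suc d ℕ.^ m) ≡ pow (recip (suc d)) m
recip-pow d zero    = refl
recip-pow d (suc m) =
  trans (recip-* (suc d) (suc d ℕ.^ m) z<s (ℕP.m^n>0 (suc d) m)) (cong (recip (suc d) *_) (recip-pow d m))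

alt : ℕ → ℚ
alt k = ιℤ (-[1+ 0 ] ℤ.^ k)

alt-suc : ∀ k → alt (suc k) ≡ - alt k
alt-suc k = begin
  ιℤ (-[1+ 0 ] ℤ.* (-[1+ 0 ] ℤ.^ k))   ≡⟨ ιℤ-* -[1+ 0 ] (-[1+ 0 ] ℤ.^ k) ⟩
  ιℤ -[1+ 0 ] * alt k                  ≡⟨ cong (_* alt k) (ιℤ-neg (+ 1)) ⟩
  - 1ℚ * alt k                         ≡⟨ -1*x≡-x (alt k) ⟩
  - alt k                              ∎
  where
  -1*x≡-x : ∀ x → - 1ℚ * x ≡ - x
  -1*x≡-x = solve-∀ ℚ-ring

alt-square : ∀ k → alt k * alt k ≡ 1ℚ
alt-square zero    = refl
alt-square (suc k) = begin
  alt (suc k) * alt (suc k)   ≡⟨ cong (λ a → a * a) (alt-suc k) ⟩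
  - alt k * - alt k           ≡⟨ -x*-x≡x*x (alt k) ⟩
  alt k * alt k               ≡⟨ alt-square k ⟩
  1ℚ                          ∎
  where
  -x*-x≡x*x : ∀ x → - x * - x ≡ x * x
  -x*-x≡x*x = solve-∀ ℚ-ring

term-split : ∀ s k → term s (suc k) ≡ ιℤ (sgnℤ s ℤ.^ suc k) * pow (recip (suc k)) ℤ.∣ s ∣
term-split s k = trans (frac≡ιℤ*recip (sgnℤ s ℤ.^ suc k) (ℕP.m^n>0 (suc k) ℤ.∣ s ∣))
                       (cong (ιℤ (sgnℤ s ℤ.^ suc k) *_) (recip-pow k ℤ.∣ s ∣))

term-pos : ∀ m k → term +[1+ m ] (suc k) ≡ pow (recip (suc k)) (suc m)
term-pos m k = begin
  term +[1+ m ] (suc k)                          ≡⟨ term-split +[1+ m ] k ⟩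
  ιℤ ((+ 1) ℤ.^ suc k) * pow (recip (suc k)) (suc m) ≡⟨ cong (λ z → ιℤ z * pow (recip (suc k)) (suc m)) (ℤP.^-zeroˡ (suc k)) ⟩
  1ℚ * pow (recip (suc k)) (suc m)                ≡⟨ ℚP.*-identityˡ _ ⟩
  pow (recip (suc k)) (suc m)                     ∎

term-neg : ∀ m k → term -[1+ m ] (suc k) ≡ alt (suc k) * pow (recip (suc k)) (suc m)
term-neg m k = term-split -[1+ m ] k

^-distribʳ-* : ∀ a b n → (a ℤ.* b) ℤ.^ n ≡ a ℤ.^ n ℤ.* b ℤ.^ n
^-distribʳ-* a b zero    = refl
^-distribʳ-* a b (suc n) = begin
  a ℤ.* b ℤ.* (a ℤ.* b) ℤ.^ n              ≡⟨ cong (a ℤ.* b ℤ.*_) (^-distribʳ-* a b n) ⟩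
  a ℤ.* b ℤ.* (a ℤ.^ n ℤ.* b ℤ.^ n)        ≡⟨ interchange a b (a ℤ.^ n) (b ℤ.^ n) ⟩
  a ℤ.* a ℤ.^ n ℤ.* (b ℤ.* b ℤ.^ n)        ∎
  where
  interchange : ∀ a b x y → a ℤ.* b ℤ.* (x ℤ.* y) ≡ a ℤ.* x ℤ.* (b ℤ.* y)
  interchange = ℤRing.solve-∀

term-⊕-by-sign-and-size : ∀ x y k → sgnℤ (x ⊕ y) ≡ sgnℤ x ℤ.* sgnℤ y → ℤ.∣ x ⊕ y ∣ ≡ ℤ.∣ x ∣ ℕ.+ ℤ.∣ y ∣ →
                          term (x ⊕ y) (suc k) ≡ term x (suc k) * term y (suc k)
term-⊕-by-sign-and-size x y k sgn-eq size-eq = begin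
  term (x ⊕ y) (suc k)
    ≡⟨ term-split (x ⊕ y) k ⟩
  ιℤ (sgnℤ (x ⊕ y) ℤ.^ suc k) * pow r ℤ.∣ x ⊕ y ∣
    ≡⟨ cong₂ (λ s e → ιℤ (s ℤ.^ suc k) * pow r e) sgn-eq size-eq ⟩
  ιℤ ((sgnℤ x ℤ.* sgnℤ y) ℤ.^ suc k) * pow r (ℤ.∣ x ∣ ℕ.+ ℤ.∣ y ∣)
    ≡⟨ cong₂ _*_ (trans (cong ιℤ (^-distribʳ-* (sgnℤ x) (sgnℤ y) (suc k))) (ιℤ-* (sgnℤ x ℤ.^ suc k) (sgnℤ y ℤ.^ suc k))) (pow-+ r ℤ.∣ x ∣ ℤ.∣ y ∣) ⟩
  sx * sy * (pow r ℤ.∣ x ∣ * pow r ℤ.∣ y ∣)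
    ≡⟨ interchange sx sy (pow r ℤ.∣ x ∣) (pow r ℤ.∣ y ∣) ⟩
  sx * pow r ℤ.∣ x ∣ * (sy * pow r ℤ.∣ y ∣)
    ≡⟨ sym (cong₂ _*_ (term-split x k) (term-split y k)) ⟩
  term x (suc k) * term y (suc k)  ∎
  where
  r = recip (suc k)
  sx = ιℤ (sgnℤ x ℤ.^ suc k)
  sy = ιℤ (sgnℤ y ℤ.^ suc k)
  interchange : ∀ a b x y → a * b * (x * y) ≡ a * x * (b * y)
  interchange = solve-∀ ℚ-ring

⊕-zeroʳ : ∀ x → x ⊕ (+ 0) ≡ + 0
⊕-zeroʳ x = trans (ℤP.+-identityʳ _) (ℤP.*-zeroʳ (sgnℤ x))

2+[b+a]≡[1+a]+[1+b] : ∀ a b → suc (suc (b ℕ.+ a)) ≡ suc a ℕ.+ suc b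
2+[b+a]≡[1+a]+[1+b] = ℕRing.solve-∀

term-⊕ : ∀ x y k → term (x ⊕ y) (suc k) ≡ term x (suc k) * term y (suc k)
term-⊕ (+ zero) y k = begin
  term (+ 0 ℤ.* y ℤ.+ sgnℤ y ℤ.* + 0) (suc k)  ≡⟨ cong (λ z → term (+ 0 ℤ.+ z) (suc k)) (ℤP.*-zeroʳ (sgnℤ y)) ⟩
  0ℚ                                        ≡⟨ sym (ℚP.*-zeroˡ (term y (suc k))) ⟩
  0ℚ * term y (suc k)                       ∎
term-⊕ x (+ zero) k = trans (cong (λ z → term z (suc k)) (⊕-zeroʳ x)) (sym (ℚP.*-zeroʳ (term x (suc k))))
term-⊕ x@(+[1+ a ]) y@(+[1+ b ]) k = term-⊕-by-sign-and-size x y k refl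
  (trans (cong ℤ.∣_∣ (cong₂ ℤ._+_ (ℤP.*-identityˡ y) (ℤP.*-identityˡ x))) (ℕP.+-comm (suc b) (suc a)))
term-⊕ x@(+[1+ a ]) y@(-[1+ b ]) k = term-⊕-by-sign-and-size x y k refl
  (trans (cong ℤ.∣_∣ (cong₂ ℤ._+_ (ℤP.*-identityˡ y) (ℤP.-1*i≡-i x))) (2+[b+a]≡[1+a]+[1+b] a b))
term-⊕ x@(-[1+ a ]) y@(+[1+ b ]) k = term-⊕-by-sign-and-size x y k refl
  (trans (cong ℤ.∣_∣ (cong₂ ℤ._+_ (ℤP.-1*i≡-i y) (ℤP.*-identityˡ x))) (2+[b+a]≡[1+a]+[1+b] a b))
term-⊕ x@(-[1+ a ]) y@(-[1+ b ]) k = term-⊕-by-sign-and-size x y k refl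
  (trans (cong ℤ.∣_∣ (cong₂ ℤ._+_ (ℤP.-1*i≡-i y) (ℤP.-1*i≡-i x))) (ℕP.+-comm (suc b) (suc a)))

infix 4 _≗₊_
_≗₊_ : (ℕ → ℚ) → (ℕ → ℚ) → Set
f ≗₊ g = ∀ k → f (suc k) ≡ g (suc k)

sumTo-cong : ∀ n {f g} → f ≗₊ g → sumTo n f ≡ sumTo n g
sumTo-cong zero    f≗g = refl
sumTo-cong (suc n) f≗g = cong₂ _+_ (sumTo-cong n f≗g) (f≗g n)

sumTo-+ : ∀ n (f g : ℕ → ℚ) → sumTo n (λ k → f k + g k) ≡ sumTo n f + sumTo n g
sumTo-+ zero    f g = refl
sumTo-+ (suc n) f g = begin
  sumTo n (λ k → f k + g k) + (f (suc n) + g (suc n))  ≡⟨ cong (_+ (f (suc n) + g (suc n))) (sumTo-+ n f g) ⟩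
  sumTo n f + sumTo n g + (f (suc n) + g (suc n))      ≡⟨ interchange (sumTo n f) (sumTo n g) (f (suc n)) (g (suc n)) ⟩
  sumTo n f + f (suc n) + (sumTo n g + g (suc n))      ∎
  where
  interchange : ∀ a b c d → a + b + (c + d) ≡ a + c + (b + d)
  interchange = solve-∀ ℚ-ring

sumTo-*ˡ : ∀ n c (f : ℕ → ℚ) → sumTo n (λ k → c * f k) ≡ c * sumTo n f
sumTo-*ˡ zero    c f = sym (ℚP.*-zeroʳ c)
sumTo-*ˡ (suc n) c f = trans (cong (_+ c * f (suc n)) (sumTo-*ˡ n c f))
                             (sym (ℚP.*-distribˡ-+ c (sumTo n f) (f (suc n))))

sumTo-neg : ∀ n (f : ℕ → ℚ) → sumTo n (λ k → - f k) ≡ - sumTo n f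
sumTo-neg n f = begin
  sumTo n (λ k → - f k)         ≡⟨ sumTo-cong n (λ k → -x≡-1*x (f (suc k))) ⟩
  sumTo n (λ k → - 1ℚ * f k)    ≡⟨ sumTo-*ˡ n (- 1ℚ) f ⟩
  - 1ℚ * sumTo n f              ≡⟨ sym (-x≡-1*x (sumTo n f)) ⟩
  - sumTo n f                   ∎
  where
  -x≡-1*x : ∀ x → - x ≡ - 1ℚ * x
  -x≡-1*x = solve-∀ ℚ-ring

-- Binomial coefficients and the weights C(N,k)/C(N+k,k)

C*factorials≡! : ∀ {n k} → k ≤ n → (n C k) ℕ.* (k ! ℕ.* (n ∸ k) !) ≡ n !
C*factorials≡! {n} {k} k≤n = trans (cong (ℕ._* (k ! ℕ.* (n ∸ k) !)) (nCk≡n!/k![n-k]! k≤n))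
  (m/n*n≡m {{k ℕP.!* (n ∸ k) !≢0}} (k![n∸k]!∣n! k≤n))

C-pos : ∀ {n k} → k ≤ n → 0 < n C k
C-pos {n} {k} k≤n = ℕ.>-nonZero⁻¹ (n C k)
  {{ℕP.m*n≢0⇒m≢0 (n C k) {{subst NonZero (sym (C*factorials≡! k≤n)) (n ℕP.!≢0)}}}}

[k+1]*nC[k+1]≡[n∸k]*nCk : ∀ n k → suc k ℕ.* (n C suc k) ≡ (n ∸ k) ℕ.* (n C k)
[k+1]*nC[k+1]≡[n∸k]*nCk n k with suc k ℕ.≤? n
... | no  k≮n = trans (cong (suc k ℕ.*_) (k>n⇒nCk≡0 (ℕP.≰⇒> k≮n)))
      (trans (ℕP.*-zeroʳ (suc k)) (sym (cong (ℕ._* (n C k)) (ℕP.m≤n⇒m∸n≡0 (ℕP.≤-pred (ℕP.≰⇒> k≮n))))))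
... | yes k<n = ℕP.*-cancelʳ-≡ _ _ (k ! ℕ.* (n ∸ suc k) !) {{k ℕP.!* (n ∸ suc k) !≢0}} (begin
  suc k ℕ.* (n C suc k) ℕ.* (k ! ℕ.* (n ∸ suc k) !)
    ≡⟨ regroup (suc k) (n C suc k) (k !) ((n ∸ suc k) !) ⟩
  (n C suc k) ℕ.* (suc k ! ℕ.* (n ∸ suc k) !)
    ≡⟨ C*factorials≡! k<n ⟩
  n !
    ≡⟨ sym (C*factorials≡! (ℕP.<⇒≤ k<n)) ⟩
  (n C k) ℕ.* (k ! ℕ.* (n ∸ k) !)
    ≡⟨ cong (λ m → (n C k) ℕ.* (k ! ℕ.* m !)) n∸k≡1+[n∸1+k] ⟩
  (n C k) ℕ.* (k ! ℕ.* suc (n ∸ suc k) !)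
    ≡⟨ regroup′ (n C k) (k !) (n ∸ suc k) ((n ∸ suc k) !) ⟩
  suc (n ∸ suc k) ℕ.* (n C k) ℕ.* (k ! ℕ.* (n ∸ suc k) !)
    ≡⟨ cong (λ m → m ℕ.* (n C k) ℕ.* (k ! ℕ.* (n ∸ suc k) !)) (sym n∸k≡1+[n∸1+k]) ⟩
  (n ∸ k) ℕ.* (n C k) ℕ.* (k ! ℕ.* (n ∸ suc k) !) ∎)
  where
  n∸k≡1+[n∸1+k] : n ∸ k ≡ suc (n ∸ suc k)
  n∸k≡1+[n∸1+k] = ℕP.+-∸-assoc 1 k<n
  regroup : ∀ a x f g → a ℕ.* x ℕ.* (f ℕ.* g) ≡ x ℕ.* (a ℕ.* f ℕ.* g)
  regroup = ℕRing.solve-∀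
  regroup′ : ∀ c f m g → c ℕ.* (f ℕ.* (suc m ℕ.* g)) ≡ suc m ℕ.* c ℕ.* (f ℕ.* g)
  regroup′ = ℕRing.solve-∀

[k+1]*[n+1]C[k+1]≡[n+1]*nCk : ∀ n k → suc k ℕ.* (suc n C suc k) ≡ suc n ℕ.* (n C k)
[k+1]*[n+1]C[k+1]≡[n+1]*nCk n k with k ℕ.≤? n
... | no  k≰n = trans (cong (suc k ℕ.*_) (k>n⇒nCk≡0 (s≤s (ℕP.≰⇒> k≰n))))
      (trans (ℕP.*-zeroʳ (suc k)) (sym (trans (cong (suc n ℕ.*_) (k>n⇒nCk≡0 (ℕP.≰⇒> k≰n))) (ℕP.*-zeroʳ (suc n)))))
... | yes k≤n = ℕP.*-cancelʳ-≡ _ _ (k ! ℕ.* (n ∸ k) !) {{k ℕP.!* (n ∸ k) !≢0}} (begin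
  suc k ℕ.* (suc n C suc k) ℕ.* (k ! ℕ.* (n ∸ k) !)
    ≡⟨ regroup (suc k) (suc n C suc k) (k !) ((n ∸ k) !) ⟩
  (suc n C suc k) ℕ.* (suc k ! ℕ.* (n ∸ k) !)
    ≡⟨ C*factorials≡! (s≤s k≤n) ⟩
  suc n ℕ.* n !
    ≡⟨ cong (suc n ℕ.*_) (sym (C*factorials≡! k≤n)) ⟩
  suc n ℕ.* ((n C k) ℕ.* (k ! ℕ.* (n ∸ k) !))
    ≡⟨ sym (ℕP.*-assoc (suc n) (n C k) (k ! ℕ.* (n ∸ k) !)) ⟩
  suc n ℕ.* (n C k) ℕ.* (k ! ℕ.* (n ∸ k) !) ∎)
  where
  regroup : ∀ a x f g → a ℕ.* x ℕ.* (f ℕ.* g) ≡ x ℕ.* (a ℕ.* f ℕ.* g)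
  regroup = ℕRing.solve-∀

[n+1∸k]*[n+1]Ck≡[n+1]*nCk : ∀ n k → (suc n ∸ k) ℕ.* (suc n C k) ≡ suc n ℕ.* (n C k)
[n+1∸k]*[n+1]Ck≡[n+1]*nCk n k =
  trans (sym ([k+1]*nC[k+1]≡[n∸k]*nCk (suc n) k)) ([k+1]*[n+1]C[k+1]≡[n+1]*nCk n k)

weight : ℕ → ℕ → ℚ
weight N k = frac (+ (N C k)) ((N ℕ.+ k) C k)

C[n+k,k]-pos : ∀ n k → 0 < (n ℕ.+ k) C k
C[n+k,k]-pos n k = C-pos (ℕP.m≤n+m k n)

weight-cross : ∀ u v N k N′ k′ →
               u ℕ.* (N C k) ℕ.* ((N′ ℕ.+ k′) C k′) ≡ v ℕ.* (N′ C k′) ℕ.* ((N ℕ.+ k) C k) →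
               ι u * weight N k ≡ ι v * weight N′ k′
weight-cross u v N k N′ k′ eq = begin
  ι u * weight N k                               ≡⟨ ι*frac u (N C k) (C[n+k,k]-pos N k) ⟩
  frac (+ (u ℕ.* (N C k))) ((N ℕ.+ k) C k)       ≡⟨ frac-cross _ _ _ _ (C[n+k,k]-pos N k) (C[n+k,k]-pos N′ k′) eq ⟩
  frac (+ (v ℕ.* (N′ C k′))) ((N′ ℕ.+ k′) C k′)  ≡⟨ sym (ι*frac v (N′ C k′) (C[n+k,k]-pos N′ k′)) ⟩
  ι v * weight N′ k′                             ∎

weight-zero : ∀ {N k} → N < k → weight N k ≡ 0ℚ
weight-zero {N} {k} N<k = begin
  frac (+ (N C k)) ((N ℕ.+ k) C k)  ≡⟨ cong (λ c → frac (+ c) ((N ℕ.+ k) C k)) (k>n⇒nCk≡0 N<k) ⟩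
  frac (+ 0) ((N ℕ.+ k) C k)        ≡⟨ frac-cross 0 0 _ 1 (C[n+k,k]-pos N k) z<s refl ⟩
  0ℚ                                ∎

ι∸*weight : ∀ N k → ι (N ∸ k) * weight N k ≡ (ι N - ι k) * weight N k
ι∸*weight N k with k ℕ.≤? N
... | yes k≤N = cong (_* weight N k) (ι-∸ k≤N)
... | no  k≰N = begin
  ι (N ∸ k) * weight N k      ≡⟨ cong (ι (N ∸ k) *_) w≡0 ⟩
  ι (N ∸ k) * 0ℚ              ≡⟨ ℚP.*-zeroʳ (ι (N ∸ k)) ⟩
  0ℚ                          ≡⟨ sym (ℚP.*-zeroʳ (ι N - ι k)) ⟩
  (ι N - ι k) * 0ℚ            ≡⟨ cong ((ι N - ι k) *_) (sym w≡0) ⟩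
  (ι N - ι k) * weight N k    ∎
  where
  w≡0 : weight N k ≡ 0ℚ
  w≡0 = weight-zero (ℕP.≰⇒> k≰N)

weight-step-k : ∀ N k → (1ℚ + ι N + ι k) * weight N (suc k) ≡ (ι N - ι k) * weight N k
weight-step-k N k = begin
  (1ℚ + ι N + ι k) * weight N (suc k)  ≡⟨ cong (_* weight N (suc k)) (sym (ι-suc-+ N k)) ⟩
  ι (suc (N ℕ.+ k)) * weight N (suc k) ≡⟨ weight-cross (suc (N ℕ.+ k)) (N ∸ k) N (suc k) N k cross ⟩
  ι (N ∸ k) * weight N k               ≡⟨ ι∸*weight N k ⟩
  (ι N - ι k) * weight N k             ∎
  where
  A  = N C k
  A′ = N C suc k
  B  = (N ℕ.+ k) C k
  B′ = (N ℕ.+ suc k) C suc k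
  [k+1]*B′≡[N+k+1]*B : suc k ℕ.* B′ ≡ suc (N ℕ.+ k) ℕ.* B
  [k+1]*B′≡[N+k+1]*B = trans (cong (λ m → suc k ℕ.* (m C suc k)) (ℕP.+-suc N k))
                             ([k+1]*[n+1]C[k+1]≡[n+1]*nCk (N ℕ.+ k) k)
  swap : ∀ a b x y → a ℕ.* (b ℕ.* x ℕ.* y) ≡ b ℕ.* (a ℕ.* x) ℕ.* y
  swap = ℕRing.solve-∀
  swap′ : ∀ a b x y → a ℕ.* (b ℕ.* x) ℕ.* y ≡ b ℕ.* x ℕ.* (a ℕ.* y)
  swap′ = ℕRing.solve-∀
  cross : suc (N ℕ.+ k) ℕ.* A′ ℕ.* B ≡ (N ∸ k) ℕ.* A ℕ.* B′
  cross = ℕP.*-cancelˡ-≡ _ _ (suc k) (begin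
    suc k ℕ.* (suc (N ℕ.+ k) ℕ.* A′ ℕ.* B)      ≡⟨ swap (suc k) (suc (N ℕ.+ k)) A′ B ⟩
    suc (N ℕ.+ k) ℕ.* (suc k ℕ.* A′) ℕ.* B      ≡⟨ cong (λ m → suc (N ℕ.+ k) ℕ.* m ℕ.* B) ([k+1]*nC[k+1]≡[n∸k]*nCk N k) ⟩
    suc (N ℕ.+ k) ℕ.* ((N ∸ k) ℕ.* A) ℕ.* B     ≡⟨ swap′ (suc (N ℕ.+ k)) (N ∸ k) A B ⟩
    (N ∸ k) ℕ.* A ℕ.* (suc (N ℕ.+ k) ℕ.* B)     ≡⟨ cong ((N ∸ k) ℕ.* A ℕ.*_) (sym [k+1]*B′≡[N+k+1]*B) ⟩
    (N ∸ k) ℕ.* A ℕ.* (suc k ℕ.* B′)            ≡⟨ sym (swap′ (suc k) (N ∸ k) A B′) ⟩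
    suc k ℕ.* ((N ∸ k) ℕ.* A) ℕ.* B′            ≡⟨ ℕP.*-assoc (suc k) ((N ∸ k) ℕ.* A) B′ ⟩
    suc k ℕ.* ((N ∸ k) ℕ.* A ℕ.* B′)            ∎)

weight-step-N : ∀ N k → ι (suc N) * ι (suc N) * weight N k ≡
                        (ι (suc N) * ι (suc N) - ι k * ι k) * weight (suc N) k
weight-step-N N k = begin
  ι (suc N) * ι (suc N) * weight N k
    ≡⟨ cong (_* weight N k) (sym (ι-* (suc N) (suc N))) ⟩
  ι (suc N ℕ.* suc N) * weight N k
    ≡⟨ weight-cross (suc N ℕ.* suc N) ((suc N ∸ k) ℕ.* (suc N ℕ.+ k)) N k (suc N) k cross ⟩
  ι ((suc N ∸ k) ℕ.* (suc N ℕ.+ k)) * weight (suc N) k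
    ≡⟨ cong (_* weight (suc N) k) (ι-* (suc N ∸ k) (suc N ℕ.+ k)) ⟩
  ι (suc N ∸ k) * ι (suc N ℕ.+ k) * weight (suc N) k
    ≡⟨ ℚP.*-assoc (ι (suc N ∸ k)) (ι (suc N ℕ.+ k)) (weight (suc N) k) ⟩
  ι (suc N ∸ k) * (ι (suc N ℕ.+ k) * weight (suc N) k)
    ≡⟨ cong (ι (suc N ∸ k) *_) (cong (_* weight (suc N) k) (ι-+ (suc N) k)) ⟩
  ι (suc N ∸ k) * ((ι (suc N) + ι k) * weight (suc N) k)
    ≡⟨ rotate (ι (suc N ∸ k)) (ι (suc N) + ι k) (weight (suc N) k) ⟩
  (ι (suc N) + ι k) * (ι (suc N ∸ k) * weight (suc N) k)
    ≡⟨ cong ((ι (suc N) + ι k) *_) (ι∸*weight (suc N) k) ⟩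
  (ι (suc N) + ι k) * ((ι (suc N) - ι k) * weight (suc N) k)
    ≡⟨ difference-of-squares (ι (suc N)) (ι k) (weight (suc N) k) ⟩
  (ι (suc N) * ι (suc N) - ι k * ι k) * weight (suc N) k ∎
  where
  A  = N C k
  A₁ = suc N C k
  B  = (N ℕ.+ k) C k
  B₁ = (suc N ℕ.+ k) C k
  rotate : ∀ a b w → a * (b * w) ≡ b * (a * w)
  rotate = solve-∀ ℚ-ring
  difference-of-squares : ∀ x y w → (x + y) * ((x - y) * w) ≡ (x * x - y * y) * w
  difference-of-squares = solve-∀ ℚ-ring
  [N+1]*B₁≡[N+k+1]*B : suc N ℕ.* B₁ ≡ suc (N ℕ.+ k) ℕ.* B
  [N+1]*B₁≡[N+k+1]*B = trans (cong (ℕ._* B₁) (sym (ℕP.m+n∸n≡m (suc N) k)))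
                             ([n+1∸k]*[n+1]Ck≡[n+1]*nCk (N ℕ.+ k) k)
  interchange : ∀ a x y → a ℕ.* a ℕ.* x ℕ.* y ≡ a ℕ.* x ℕ.* (a ℕ.* y)
  interchange = ℕRing.solve-∀
  interchange′ : ∀ a b x y → a ℕ.* x ℕ.* (b ℕ.* y) ≡ a ℕ.* b ℕ.* x ℕ.* y
  interchange′ = ℕRing.solve-∀
  cross : suc N ℕ.* suc N ℕ.* A ℕ.* B₁ ≡ (suc N ∸ k) ℕ.* (suc N ℕ.+ k) ℕ.* A₁ ℕ.* B
  cross = begin
    suc N ℕ.* suc N ℕ.* A ℕ.* B₁                     ≡⟨ interchange (suc N) A B₁ ⟩
    suc N ℕ.* A ℕ.* (suc N ℕ.* B₁)                   ≡⟨ cong₂ ℕ._*_ (sym ([n+1∸k]*[n+1]Ck≡[n+1]*nCk N k)) [N+1]*B₁≡[N+k+1]*B ⟩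
    (suc N ∸ k) ℕ.* A₁ ℕ.* (suc (N ℕ.+ k) ℕ.* B)     ≡⟨ interchange′ (suc N ∸ k) (suc N ℕ.+ k) A₁ B ⟩
    (suc N ∸ k) ℕ.* (suc N ℕ.+ k) ℕ.* A₁ ℕ.* B       ∎

-- The transform 𝕋

𝕋 : ℕ → (ℕ → ℚ) → ℚ
𝕋 N f = sumTo N (λ k → weight N k * f k)

𝕋-cong : ∀ N {f g} → f ≗₊ g → 𝕋 N f ≡ 𝕋 N g
𝕋-cong N f≗g = sumTo-cong N (λ k → cong (weight N (suc k) *_) (f≗g k))

2ℚ : ℚ
2ℚ = 1ℚ + 1ℚ

Λ : (ℕ → ℚ) → ℕ → ℚ
Λ g k = g k + 2ℚ * sumTo (k ∸ 1) g

Λ± : (ℕ → ℚ) → ℕ → ℚ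
Λ± g k = g k + 2ℚ * alt k * sumTo (k ∸ 1) (λ i → alt i * g i)

Λ-cong : ∀ {f g} → f ≗₊ g → Λ f ≗₊ Λ g
Λ-cong {f} {g} f≗g k = cong₂ (λ x s → x + 2ℚ * s) (f≗g k) (sumTo-cong k f≗g)

Λ±-alt : ∀ g → Λ± (λ i → alt i * g i) ≗₊ (λ k → alt k * Λ g k)
Λ±-alt g k = begin
  s * g (suc k) + 2ℚ * s * sumTo k (λ i → alt i * (alt i * g i))
    ≡⟨ cong (λ u → s * g (suc k) + 2ℚ * s * u) (sumTo-cong k alt²g≡g) ⟩
  s * g (suc k) + 2ℚ * s * sumTo k g
    ≡⟨ factor s (g (suc k)) (sumTo k g) ⟩
  s * (g (suc k) + 2ℚ * sumTo k g) ∎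
  where
  s = alt (suc k)
  alt²g≡g : (λ i → alt i * (alt i * g i)) ≗₊ g
  alt²g≡g i = begin
    alt (suc i) * (alt (suc i) * g (suc i))   ≡⟨ sym (ℚP.*-assoc (alt (suc i)) (alt (suc i)) (g (suc i))) ⟩
    alt (suc i) * alt (suc i) * g (suc i)     ≡⟨ cong (_* g (suc i)) (alt-square (suc i)) ⟩
    1ℚ * g (suc i)                            ≡⟨ ℚP.*-identityˡ (g (suc i)) ⟩
    g (suc i)                                 ∎
  factor : ∀ s x u → s * x + 2ℚ * s * u ≡ s * (x + 2ℚ * u)
  factor = solve-∀ ℚ-ring

𝕋-ι-Λ-partial : ∀ N g m →
  sumTo m (λ k → weight N k * (ι k * Λ g k)) ≡
  ι N * sumTo m (λ k → weight N k * g k) - (ι N - ι m) * weight N m * sumTo m g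
𝕋-ι-Λ-partial N g zero = base (ι N)
  where
  base : ∀ x → 0ℚ ≡ x * 0ℚ - (x - 0ℚ) * 1ℚ * 0ℚ
  base = solve-∀ ℚ-ring
𝕋-ι-Λ-partial N g (suc m) = begin
  L′ + w′ * (ι (suc m) * (G + 2ℚ * U))
    ≡⟨ cong₂ (λ a i → a + w′ * (i * (G + 2ℚ * U))) (𝕋-ι-Λ-partial N g m) (ι-suc m) ⟩
  ι N * L - (ι N - ι m) * w * U + w′ * ((1ℚ + ι m) * (G + 2ℚ * U))
    ≡⟨ ≡-modulo U (weight-step-k N m) (step (ι N) (ι m) w w′ G U L) ⟩
  ι N * (L + w′ * G) - (ι N - (1ℚ + ι m)) * w′ * (U + G)
    ≡⟨ cong (λ i → ι N * (L + w′ * G) - (ι N - i) * w′ * (U + G)) (sym (ι-suc m)) ⟩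
  ι N * (L + w′ * G) - (ι N - ι (suc m)) * w′ * (U + G) ∎
  where
  w  = weight N m
  w′ = weight N (suc m)
  G  = g (suc m)
  U  = sumTo m g
  L  = sumTo m (λ k → weight N k * g k)
  L′ = sumTo m (λ k → weight N k * (ι k * Λ g k))
  step : ∀ x y w w′ G U L →
         x * L - (x - y) * w * U + w′ * ((1ℚ + y) * (G + 2ℚ * U)) ≡
         x * (L + w′ * G) - (x - (1ℚ + y)) * w′ * (U + G) + U * ((1ℚ + x + y) * w′ - (x - y) * w)
  step = solve-∀ ℚ-ring

𝕋-ι-Λ : ∀ N g → 𝕋 N (λ k → ι k * Λ g k) ≡ ι N * 𝕋 N g
𝕋-ι-Λ N g = trans (𝕋-ι-Λ-partial N g N) (drop (ι N) (𝕋 N g) (weight N N) (sumTo N g))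
  where
  drop : ∀ x t w u → x * t - (x - x) * w * u ≡ x * t
  drop = solve-∀ ℚ-ring

𝕋-Λ±-partial : ∀ N g m →
  ι N * sumTo m (λ k → weight N k * Λ± g k) ≡
  sumTo m (λ k → weight N k * (ι k * g k)) + alt m * (ι N - ι m) * weight N m * sumTo m (λ i → alt i * g i)
𝕋-Λ±-partial N g zero = base (ι N)
  where
  base : ∀ x → x * 0ℚ ≡ 0ℚ + 1ℚ * (x - 0ℚ) * 1ℚ * 0ℚ
  base = solve-∀ ℚ-ring
𝕋-Λ±-partial N g (suc m) = begin
  ι N * (L₁ + w′ * (G + 2ℚ * alt (suc m) * U))
    ≡⟨ ℚP.*-distribˡ-+ (ι N) L₁ (w′ * (G + 2ℚ * alt (suc m) * U)) ⟩
  ι N * L₁ + ι N * (w′ * (G + 2ℚ * alt (suc m) * U))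
    ≡⟨ cong₂ (λ a s′ → a + ι N * (w′ * (G + 2ℚ * s′ * U))) (𝕋-Λ±-partial N g m) (alt-suc m) ⟩
  L₂ + s * (ι N - ι m) * w * U + ι N * (w′ * (G + 2ℚ * - s * U))
    ≡⟨ ≡-modulo₂ (- (s * U)) (- (w′ * G * (ι N - (1ℚ + ι m)))) (weight-step-k N m) (alt-square m)
                 (step (ι N) (ι m) w w′ s G U L₂) ⟩
  L₂ + w′ * ((1ℚ + ι m) * G) + - s * (ι N - (1ℚ + ι m)) * w′ * (U + - s * G)
    ≡⟨ cong₂ (λ s′ i → L₂ + w′ * (i * G) + s′ * (ι N - i) * w′ * (U + s′ * G)) (sym (alt-suc m)) (sym (ι-suc m)) ⟩
  L₂ + w′ * (ι (suc m) * G) + alt (suc m) * (ι N - ι (suc m)) * w′ * (U + alt (suc m) * G) ∎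
  where
  s  = alt m
  w  = weight N m
  w′ = weight N (suc m)
  G  = g (suc m)
  U  = sumTo m (λ i → alt i * g i)
  L₁ = sumTo m (λ k → weight N k * Λ± g k)
  L₂ = sumTo m (λ k → weight N k * (ι k * g k))
  step : ∀ x y w w′ s G U L₂ →
         L₂ + s * (x - y) * w * U + x * (w′ * (G + 2ℚ * - s * U)) ≡
         L₂ + w′ * ((1ℚ + y) * G) + - s * (x - (1ℚ + y)) * w′ * (U + - s * G)
         + - (s * U) * ((1ℚ + x + y) * w′ - (x - y) * w)
         + - (w′ * G * (x - (1ℚ + y))) * (s * s - 1ℚ)
  step = solve-∀ ℚ-ring

𝕋-Λ± : ∀ N g → ι N * 𝕋 N (Λ± g) ≡ 𝕋 N (λ k → ι k * g k)
𝕋-Λ± N g = trans (𝕋-Λ±-partial N g N)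
  (drop (𝕋 N (λ k → ι k * g k)) (alt N) (ι N) (weight N N) (sumTo N (λ i → alt i * g i)))
  where
  drop : ∀ t s x w u → t + s * (x - x) * w * u ≡ t
  drop = solve-∀ ℚ-ring

𝕋-alt-partial : ∀ N m → ι N * sumTo m (λ k → weight N k * (2ℚ * alt k)) ≡ alt m * (ι N - ι m) * weight N m - ι N
𝕋-alt-partial N zero = base (ι N)
  where
  base : ∀ x → x * 0ℚ ≡ 1ℚ * (x - 0ℚ) * 1ℚ - x
  base = solve-∀ ℚ-ring
𝕋-alt-partial N (suc m) = begin
  ι N * (L + w′ * (2ℚ * alt (suc m)))
    ≡⟨ ℚP.*-distribˡ-+ (ι N) L (w′ * (2ℚ * alt (suc m))) ⟩
  ι N * L + ι N * (w′ * (2ℚ * alt (suc m)))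
    ≡⟨ cong₂ (λ a s′ → a + ι N * (w′ * (2ℚ * s′))) (𝕋-alt-partial N m) (alt-suc m) ⟩
  s * (ι N - ι m) * w - ι N + ι N * (w′ * (2ℚ * - s))
    ≡⟨ ≡-modulo (- s) (weight-step-k N m) (step (ι N) (ι m) w w′ s) ⟩
  - s * (ι N - (1ℚ + ι m)) * w′ - ι N
    ≡⟨ cong₂ (λ s′ i → s′ * (ι N - i) * w′ - ι N) (sym (alt-suc m)) (sym (ι-suc m)) ⟩
  alt (suc m) * (ι N - ι (suc m)) * w′ - ι N ∎
  where
  s  = alt m
  w  = weight N m
  w′ = weight N (suc m)
  L  = sumTo m (λ k → weight N k * (2ℚ * alt k))
  step : ∀ x y w w′ s →
         s * (x - y) * w - x + x * (w′ * (2ℚ * - s)) ≡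
         - s * (x - (1ℚ + y)) * w′ - x + - s * ((1ℚ + x + y) * w′ - (x - y) * w)
  step = solve-∀ ℚ-ring

𝕋-2alt : ∀ n → 𝕋 (suc n) (λ k → 2ℚ * alt k) ≡ - 1ℚ
𝕋-2alt n = ι-suc-cancel n (begin
  ι (suc n) * 𝕋 (suc n) (λ k → 2ℚ * alt k)                          ≡⟨ 𝕋-alt-partial (suc n) (suc n) ⟩
  alt (suc n) * (ι (suc n) - ι (suc n)) * weight (suc n) (suc n) - ι (suc n)  ≡⟨ drop (alt (suc n)) (ι (suc n)) (weight (suc n) (suc n)) ⟩
  ι (suc n) * - 1ℚ                                                  ∎)
  where
  drop : ∀ s x w → s * (x - x) * w - x ≡ x * - 1ℚ
  drop = solve-∀ ℚ-ring

𝕋-suc-difference : ∀ N f → ι (suc N) * ι (suc N) * (𝕋 (suc N) f - 𝕋 N f) ≡ 𝕋 (suc N) (λ k → ι k * ι k * f k)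
𝕋-suc-difference N f = begin
  M * (A + c * F - 𝕋 N f)             ≡⟨ distrib M A (c * F) (𝕋 N f) ⟩
  M * A + M * (c * F) - M * 𝕋 N f     ≡⟨ cong (λ t → M * A + M * (c * F) - t) M*𝕋 ⟩
  M * A + M * (c * F) - (M * A + - C) ≡⟨ collect M A c F C ⟩
  C + c * (M * F)                     ∎
  where
  M = ι (suc N) * ι (suc N)
  A = sumTo N (λ k → weight (suc N) k * f k)
  C = sumTo N (λ k → weight (suc N) k * (ι k * ι k * f k))
  c = weight (suc N) (suc N)
  F = f (suc N)
  distrib : ∀ m a x t → m * (a + x - t) ≡ m * a + m * x - m * t
  distrib = solve-∀ ℚ-ring
  collect : ∀ m a c F C → m * a + m * (c * F) - (m * a + - C) ≡ C + c * (m * F)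
  collect = solve-∀ ℚ-ring
  pointwise : ∀ k → M * (weight N (suc k) * f (suc k)) ≡
              M * (weight (suc N) (suc k) * f (suc k)) + - (weight (suc N) (suc k) * (ι (suc k) * ι (suc k) * f (suc k)))
  pointwise k = ≡-modulo (f (suc k)) (weight-step-N N (suc k))
                  (split M (weight N (suc k)) (weight (suc N) (suc k)) (ι (suc k)) (f (suc k)))
    where
    split : ∀ m w w′ i F → m * (w * F) ≡ m * (w′ * F) + - (w′ * (i * i * F)) + F * (m * w - (m - i * i) * w′)
    split = solve-∀ ℚ-ring
  M*𝕋 : M * 𝕋 N f ≡ M * A + - C
  M*𝕋 = begin
    M * 𝕋 N f
      ≡⟨ sym (sumTo-*ˡ N M (λ k → weight N k * f k)) ⟩
    sumTo N (λ k → M * (weight N k * f k))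
      ≡⟨ sumTo-cong N pointwise ⟩
    sumTo N (λ k → M * (weight (suc N) k * f k) + - (weight (suc N) k * (ι k * ι k * f k)))
      ≡⟨ sumTo-+ N _ _ ⟩
    sumTo N (λ k → M * (weight (suc N) k * f k)) + sumTo N (λ k → - (weight (suc N) k * (ι k * ι k * f k)))
      ≡⟨ cong₂ _+_ (sumTo-*ˡ N M (λ k → weight (suc N) k * f k)) (sumTo-neg N (λ k → weight (suc N) k * (ι k * ι k * f k))) ⟩
    M * A + - C ∎

𝕋-telescope : ∀ (f g e : ℕ → ℚ) →
  (∀ N → 𝕋 (suc N) (λ k → ι k * ι k * g k) ≡ ι (suc N) * ι (suc N) * (e (suc N) * 𝕋 (suc N) f)) →
  ∀ n → 𝕋 n g ≡ sumTo n (λ m → e m * 𝕋 m f)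
𝕋-telescope f g e hyp zero    = refl
𝕋-telescope f g e hyp (suc n) = begin
  𝕋 (suc n) g                             ≡⟨ x≡y+[x-y] (𝕋 (suc n) g) (𝕋 n g) ⟩
  𝕋 n g + (𝕋 (suc n) g - 𝕋 n g)           ≡⟨ cong₂ _+_ (𝕋-telescope f g e hyp n) increment ⟩
  sumTo n (λ m → e m * 𝕋 m f) + e (suc n) * 𝕋 (suc n) f ∎
  where
  x≡y+[x-y] : ∀ x y → x ≡ y + (x - y)
  x≡y+[x-y] = solve-∀ ℚ-ring
  increment : 𝕋 (suc n) g - 𝕋 n g ≡ e (suc n) * 𝕋 (suc n) f
  increment = ι²-suc-cancel n (trans (𝕋-suc-difference n g) (hyp n))

-- Transfer rules

ι²*term2 : ∀ k x → ι (suc k) * ι (suc k) * (term (+ 2) (suc k) * x) ≡ x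
ι²*term2 k x = begin
  i * i * (term (+ 2) (suc k) * x)   ≡⟨ cong (λ t → i * i * (t * x)) (term-pos 1 k) ⟩
  i * i * (r * (r * 1ℚ) * x)         ≡⟨ regroup i r x ⟩
  i * (r * (i * (r * x)))            ≡⟨ ι*recip-cancel k (i * (r * x)) ⟩
  i * (r * x)                        ≡⟨ ι*recip-cancel k x ⟩
  x                                  ∎
  where
  i = ι (suc k)
  r = recip (suc k)
  regroup : ∀ i r x → i * i * (r * (r * 1ℚ) * x) ≡ i * (r * (i * (r * x)))
  regroup = solve-∀ ℚ-ring

ι²*term1 : ∀ k x → ι (suc k) * ι (suc k) * (term (+ 1) (suc k) * x) ≡ ι (suc k) * x
ι²*term1 k x = begin
  i * i * (term (+ 1) (suc k) * x)   ≡⟨ cong (λ t → i * i * (t * x)) (term-pos 0 k) ⟩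
  i * i * (r * 1ℚ * x)               ≡⟨ regroup i r x ⟩
  i * (i * (r * x))                  ≡⟨ cong (i *_) (ι*recip-cancel k x) ⟩
  i * x                              ∎
  where
  i = ι (suc k)
  r = recip (suc k)
  regroup : ∀ i r x → i * i * (r * 1ℚ * x) ≡ i * (i * (r * x))
  regroup = solve-∀ ℚ-ring

ι²*term-bar2 : ∀ k x → ι (suc k) * ι (suc k) * (term (bar 2) (suc k) * x) ≡ alt (suc k) * x
ι²*term-bar2 k x = begin
  i * i * (term (bar 2) (suc k) * x)   ≡⟨ cong (λ t → i * i * (t * x)) (term-neg 1 k) ⟩
  i * i * (s * (r * (r * 1ℚ)) * x)     ≡⟨ regroup i r s x ⟩
  i * (r * (i * (r * (s * x))))        ≡⟨ ι*recip-cancel k (i * (r * (s * x))) ⟩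
  i * (r * (s * x))                    ≡⟨ ι*recip-cancel k (s * x) ⟩
  s * x                                ∎
  where
  i = ι (suc k)
  r = recip (suc k)
  s = alt (suc k)
  regroup : ∀ i r s x → i * i * (s * (r * (r * 1ℚ)) * x) ≡ i * (r * (i * (r * (s * x))))
  regroup = solve-∀ ℚ-ring

ι*alt*term-bar1 : ∀ k x → ι (suc k) * (alt (suc k) * (term (bar 1) (suc k) * x)) ≡ x
ι*alt*term-bar1 k x = begin
  i * (s * (term (bar 1) (suc k) * x))   ≡⟨ cong (λ t → i * (s * (t * x))) (term-neg 0 k) ⟩
  i * (s * (s * (r * 1ℚ) * x))           ≡⟨ regroup i r s x ⟩
  s * s * (i * (r * x))                  ≡⟨ cong₂ _*_ (alt-square (suc k)) (ι*recip-cancel k x) ⟩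
  1ℚ * x                                 ≡⟨ ℚP.*-identityˡ x ⟩
  x                                      ∎
  where
  i = ι (suc k)
  r = recip (suc k)
  s = alt (suc k)
  regroup : ∀ i r s x → i * (s * (s * (r * 1ℚ) * x)) ≡ s * s * (i * (r * x))
  regroup = solve-∀ ℚ-ring

ι*alt*term1 : ∀ k x → ι (suc k) * (alt (suc k) * (term (+ 1) (suc k) * x)) ≡ alt (suc k) * x
ι*alt*term1 k x = begin
  i * (s * (term (+ 1) (suc k) * x))   ≡⟨ cong (λ t → i * (s * (t * x))) (term-pos 0 k) ⟩
  i * (s * (r * 1ℚ * x))               ≡⟨ regroup i r s x ⟩
  i * (r * (s * x))                    ≡⟨ ι*recip-cancel k (s * x) ⟩
  s * x                                ∎
  where
  i = ι (suc k)
  r = recip (suc k)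
  s = alt (suc k)
  regroup : ∀ i r s x → i * (s * (r * 1ℚ * x)) ≡ i * (r * (s * x))
  regroup = solve-∀ ℚ-ring

𝕋-term2 : ∀ f n → 𝕋 n (λ k → term (+ 2) k * f k) ≡ sumTo n (λ m → term (+ 2) m * 𝕋 m f)
𝕋-term2 f = 𝕋-telescope f (λ k → term (+ 2) k * f k) (term (+ 2)) λ N → begin
  𝕋 (suc N) (λ k → ι k * ι k * (term (+ 2) k * f k))           ≡⟨ 𝕋-cong (suc N) (λ k → ι²*term2 k (f (suc k))) ⟩
  𝕋 (suc N) f                                                  ≡⟨ sym (ι²*term2 N (𝕋 (suc N) f)) ⟩
  ι (suc N) * ι (suc N) * (term (+ 2) (suc N) * 𝕋 (suc N) f)   ∎

𝕋-term1 : ∀ f n → 𝕋 n (λ k → term (+ 1) k * Λ f k) ≡ sumTo n (λ m → term (+ 1) m * 𝕋 m f)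
𝕋-term1 f = 𝕋-telescope f (λ k → term (+ 1) k * Λ f k) (term (+ 1)) λ N → begin
  𝕋 (suc N) (λ k → ι k * ι k * (term (+ 1) k * Λ f k))         ≡⟨ 𝕋-cong (suc N) (λ k → ι²*term1 k (Λ f (suc k))) ⟩
  𝕋 (suc N) (λ k → ι k * Λ f k)                                ≡⟨ 𝕋-ι-Λ (suc N) f ⟩
  ι (suc N) * 𝕋 (suc N) f                                      ≡⟨ sym (ι²*term1 N (𝕋 (suc N) f)) ⟩
  ι (suc N) * ι (suc N) * (term (+ 1) (suc N) * 𝕋 (suc N) f)   ∎

chain : ℕ → (ℕ → ℚ) → ℕ → ℚ
chain zero    f k = term (bar 1) k * f k
chain (suc j) f k = term (+ 1) k * Λ (chain j f) k

𝕋-ι-alt-chain : ∀ j N f → 𝕋 (suc N) (λ k → ι k * (alt k * chain j f k)) ≡ pow (recip (suc N)) j * 𝕋 (suc N) f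
𝕋-Λ±-alt-chain : ∀ j N f → 𝕋 (suc N) (Λ± (λ k → alt k * chain j f k)) ≡ pow (recip (suc N)) (suc j) * 𝕋 (suc N) f

𝕋-ι-alt-chain zero N f = begin
  𝕋 (suc N) (λ k → ι k * (alt k * chain zero f k))   ≡⟨ 𝕋-cong (suc N) (λ k → ι*alt*term-bar1 k (f (suc k))) ⟩
  𝕋 (suc N) f                                          ≡⟨ sym (ℚP.*-identityˡ (𝕋 (suc N) f)) ⟩
  1ℚ * 𝕋 (suc N) f                                     ∎
𝕋-ι-alt-chain (suc j) N f = begin
  𝕋 (suc N) (λ k → ι k * (alt k * chain (suc j) f k))
    ≡⟨ 𝕋-cong (suc N) (λ k → trans (ι*alt*term1 k (Λ (chain j f) (suc k))) (sym (Λ±-alt (chain j f) k))) ⟩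
  𝕋 (suc N) (Λ± (λ k → alt k * chain j f k))
    ≡⟨ 𝕋-Λ±-alt-chain j N f ⟩
  pow (recip (suc N)) (suc j) * 𝕋 (suc N) f ∎

𝕋-Λ±-alt-chain j N f = begin
  𝕋 (suc N) (Λ± g)                          ≡⟨ sym (recip*ι-cancel N (𝕋 (suc N) (Λ± g))) ⟩
  r * (ι (suc N) * 𝕋 (suc N) (Λ± g))        ≡⟨ cong (r *_) (𝕋-Λ± (suc N) g) ⟩
  r * 𝕋 (suc N) (λ k → ι k * g k)           ≡⟨ cong (r *_) (𝕋-ι-alt-chain j N f) ⟩
  r * (pow r j * 𝕋 (suc N) f)               ≡⟨ sym (ℚP.*-assoc r (pow r j) (𝕋 (suc N) f)) ⟩
  pow r (suc j) * 𝕋 (suc N) f               ∎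
  where
  g = λ k → alt k * chain j f k
  r = recip (suc N)

ι²*term3+ : ∀ k j x → ι (suc k) * ι (suc k) * (term (+ (3 ℕ.+ j)) (suc k) * x) ≡ pow (recip (suc k)) (suc j) * x
ι²*term3+ k j x = begin
  i * i * (term (+ (3 ℕ.+ j)) (suc k) * x)   ≡⟨ cong (λ t → i * i * (t * x)) (term-pos (2 ℕ.+ j) k) ⟩
  i * i * (r * (r * (r * p)) * x)            ≡⟨ regroup i r p x ⟩
  i * (r * (i * (r * (r * p * x))))          ≡⟨ ι*recip-cancel k (i * (r * (r * p * x))) ⟩
  i * (r * (r * p * x))                      ≡⟨ ι*recip-cancel k (r * p * x) ⟩
  r * p * x                                  ∎
  where
  i = ι (suc k)
  r = recip (suc k)
  p = pow r j
  regroup : ∀ i r p x → i * i * (r * (r * (r * p)) * x) ≡ i * (r * (i * (r * (r * p * x))))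
  regroup = solve-∀ ℚ-ring

𝕋-term3+ : ∀ j f n → 𝕋 n (λ k → term (bar 2) k * Λ (chain j f) k) ≡ sumTo n (λ m → term (+ (3 ℕ.+ j)) m * 𝕋 m f)
𝕋-term3+ j f = 𝕋-telescope f (λ k → term (bar 2) k * Λ (chain j f) k) (term (+ (3 ℕ.+ j))) λ N → begin
  𝕋 (suc N) (λ k → ι k * ι k * (term (bar 2) k * Λ (chain j f) k))
    ≡⟨ 𝕋-cong (suc N) (λ k → trans (ι²*term-bar2 k (Λ (chain j f) (suc k))) (sym (Λ±-alt (chain j f) k))) ⟩
  𝕋 (suc N) (Λ± (λ k → alt k * chain j f k))
    ≡⟨ 𝕋-Λ±-alt-chain j N f ⟩
  pow (recip (suc N)) (suc j) * 𝕋 (suc N) f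
    ≡⟨ sym (ι²*term3+ N j (𝕋 (suc N) f)) ⟩
  ι (suc N) * ι (suc N) * (term (+ (3 ℕ.+ j)) (suc N) * 𝕋 (suc N) f) ∎

-- The sum over Π as a transform

kernel      : List ℤ → ℕ → ℚ
tail-factor : List ℤ → ℕ → ℚ

kernel []      k = 0ℚ
kernel (x ∷ R) k = term x k * tail-factor R k

tail-factor []      k = 2ℚ
tail-factor (y ∷ R)   = Λ (kernel (y ∷ R))

sumList : ∀ {A : Set} → (A → ℚ) → List A → ℚ
sumList f []       = 0ℚ
sumList f (p ∷ ps) = f p + sumList f ps

sumList-unique : ∀ {A : Set} (f : A → ℚ) (g : List A → ℚ) → g [] ≡ 0ℚ → (∀ p L → g (p ∷ L) ≡ f p + g L) →
                 ∀ L → g L ≡ sumList f L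
sumList-unique f g g[] g∷ []      = g[]
sumList-unique f g g[] g∷ (p ∷ L) = trans (g∷ p L) (cong (_+_ (f p)) (sumList-unique f g g[] g∷ L))

sumList-++ : ∀ {A : Set} (f : A → ℚ) L M → sumList f (L ++ M) ≡ sumList f L + sumList f M
sumList-++ f []      M = sym (ℚP.+-identityˡ (sumList f M))
sumList-++ f (p ∷ L) M = trans (cong (_+_ (f p)) (sumList-++ f L M)) (sym (ℚP.+-assoc (f p) (sumList f L) (sumList f M)))

sumList-map : ∀ {A : Set} (f : A → ℚ) (g : A → A) L → sumList f (map g L) ≡ sumList (λ p → f (g p)) L
sumList-map f g []      = refl
sumList-map f g (p ∷ L) = cong (_+_ (f (g p))) (sumList-map f g L)

sumList-cong : ∀ {A : Set} {P : A → Set} {f g : A → ℚ} → (∀ {p} → P p → f p ≡ g p) →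
               ∀ {L} → All P L → sumList f L ≡ sumList g L
sumList-cong f≡g []         = refl
sumList-cong f≡g (Pp ∷ PL) = cong₂ _+_ (f≡g Pp) (sumList-cong f≡g PL)

sumList-*ˡ : ∀ {A : Set} c (f : A → ℚ) L → sumList (λ p → c * f p) L ≡ c * sumList f L
sumList-*ˡ c f []      = sym (ℚP.*-zeroʳ c)
sumList-*ˡ c f (p ∷ L) = trans (cong (_+_ (c * f p)) (sumList-*ˡ c f L)) (sym (ℚP.*-distribˡ-+ c (f p) (sumList f L)))

sumTo-zero : ∀ n → sumTo n (λ _ → 0ℚ) ≡ 0ℚ
sumTo-zero zero    = refl
sumTo-zero (suc n) = cong (_+ 0ℚ) (sumTo-zero n)

sumList-sumTo : ∀ {A : Set} n (F : A → ℕ → ℚ) L →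
                sumList (λ p → sumTo n (F p)) L ≡ sumTo n (λ k → sumList (λ p → F p k) L)
sumList-sumTo n F []      = sym (sumTo-zero n)
sumList-sumTo n F (p ∷ L) = trans (cong (_+_ (sumTo n (F p))) (sumList-sumTo n F L))
                                  (sym (sumTo-+ n (F p) (λ k → sumList (λ q → F q k) L)))

sumList-𝕋 : ∀ {A : Set} n (F : A → ℕ → ℚ) L → sumList (λ p → 𝕋 n (F p)) L ≡ 𝕋 n (λ k → sumList (λ p → F p k) L)
sumList-𝕋 n F L = trans (sumList-sumTo n (λ p k → weight n k * F p k) L)
                        (sumTo-cong n (λ k → sumList-*ˡ (weight n (suc k)) (λ p → F p (suc k)) L))

summand : ℕ → List ℤ → ℚ
summand k []       = 0ℚ
summand k (x ∷ ps) = ι (2 ℕ.^ length (x ∷ ps)) * (term x k * H (k ∸ 1) ps)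

sumΠ≡sumList : ∀ n Q → sumΠ n Q ≡ sumList (λ p → ι (2 ℕ.^ length p) * calH n p) (Π Q)
-- Abstracting Π Q lets unification recover the local summation function of sumΠ.
sumΠ≡sumList n Q with sumList-unique (λ p → ι (2 ℕ.^ length p) * calH n p) _ refl (λ _ _ → refl) | Π Q
... | unique | L = unique L

weighted-calH≡𝕋 : ∀ n p → ι (2 ℕ.^ length p) * calH n p ≡ 𝕋 n (λ k → summand k p)
weighted-calH≡𝕋 n [] = sym (trans (sumTo-cong n (λ k → ℚP.*-zeroʳ (weight n (suc k)))) (sumTo-zero n))
weighted-calH≡𝕋 n (x ∷ ps) = begin
  c * sumTo n (λ k → term x k * weight n k * H (k ∸ 1) ps)     ≡⟨ sym (sumTo-*ˡ n c _) ⟩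
  sumTo n (λ k → c * (term x k * weight n k * H (k ∸ 1) ps))   ≡⟨ sumTo-cong n (λ k → regroup c (term x (suc k)) (weight n (suc k)) (H k ps)) ⟩
  𝕋 n (λ k → summand k (x ∷ ps))                               ∎
  where
  c = ι (2 ℕ.^ length (x ∷ ps))
  regroup : ∀ c t w h → c * (t * w * h) ≡ w * (c * (t * h))
  regroup = solve-∀ ℚ-ring

NonEmpty : List ℤ → Set
NonEmpty p = p ≢ []

H≡sumTo-summand : ∀ k {p} → NonEmpty p → ι (2 ℕ.^ length p) * H k p ≡ sumTo k (λ i → summand i p)
H≡sumTo-summand k {[]}     ne = ⊥-elim (ne refl)
H≡sumTo-summand k {x ∷ ps} ne = sym (sumTo-*ˡ k (ι (2 ℕ.^ length (x ∷ ps))) (λ i → term x i * H (i ∸ 1) ps))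

summand-cons : ∀ k x p → summand k (x ∷ p) ≡ 2ℚ * term x k * (ι (2 ℕ.^ length p) * H (k ∸ 1) p)
summand-cons k x p = begin
  ι (2 ℕ.* 2 ℕ.^ length p) * (term x k * H (k ∸ 1) p)     ≡⟨ cong (_* (term x k * H (k ∸ 1) p)) (ι-* 2 (2 ℕ.^ length p)) ⟩
  2ℚ * ι (2 ℕ.^ length p) * (term x k * H (k ∸ 1) p)      ≡⟨ regroup 2ℚ (ι (2 ℕ.^ length p)) (term x k) (H (k ∸ 1) p) ⟩
  2ℚ * term x k * (ι (2 ℕ.^ length p) * H (k ∸ 1) p)      ∎
  where
  regroup : ∀ a c t h → a * c * (t * h) ≡ a * t * (c * h)
  regroup = solve-∀ ℚ-ring

summand-mergeHead : ∀ k x {p} → NonEmpty p → summand (suc k) (mergeHead x p) ≡ term x (suc k) * summand (suc k) p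
summand-mergeHead k x {[]}     ne = ⊥-elim (ne refl)
summand-mergeHead k x {y ∷ ps} ne = begin
  c * (term (x ⊕ y) (suc k) * H k ps)                   ≡⟨ cong (λ t → c * (t * H k ps)) (term-⊕ x y k) ⟩
  c * (term x (suc k) * term y (suc k) * H k ps)        ≡⟨ regroup c (term x (suc k)) (term y (suc k)) (H k ps) ⟩
  term x (suc k) * (c * (term y (suc k) * H k ps))      ∎
  where
  c = ι (2 ℕ.^ length (y ∷ ps))
  regroup : ∀ c s t h → c * (s * t * h) ≡ s * (c * (t * h))
  regroup = solve-∀ ℚ-ring

Π-nonempty : ∀ y R → All NonEmpty (Π (y ∷ R))
Π-nonempty y []       = (λ ()) ∷ []
Π-nonempty y (z ∷ R) = ++⁺ (map⁺ (All.universal (λ _ ()) (Π (z ∷ R))))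
                           (map⁺ (All.universal mergeHead-nonempty (Π (z ∷ R))))
  where
  mergeHead-nonempty : ∀ p → NonEmpty (mergeHead y p)
  mergeHead-nonempty []      ()
  mergeHead-nonempty (_ ∷ _) ()

Π-kernel : ∀ x R k → sumList (summand (suc k)) (Π (x ∷ R)) ≡ kernel (x ∷ R) (suc k)
Π-kernel x [] k = singleton (term x (suc k))
  where
  singleton : ∀ t → 2ℚ * (t * 1ℚ) + 0ℚ ≡ t * 2ℚ
  singleton = solve-∀ ℚ-ring
Π-kernel x (y ∷ R) k = begin
  sumList (summand (suc k)) (map (x ∷_) L ++ map (mergeHead x) L)
    ≡⟨ sumList-++ (summand (suc k)) (map (x ∷_) L) (map (mergeHead x) L) ⟩
  sumList (summand (suc k)) (map (x ∷_) L) + sumList (summand (suc k)) (map (mergeHead x) L)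
    ≡⟨ cong₂ _+_ (sumList-map (summand (suc k)) (x ∷_) L) (sumList-map (summand (suc k)) (mergeHead x) L) ⟩
  sumList (λ p → summand (suc k) (x ∷ p)) L + sumList (λ p → summand (suc k) (mergeHead x p)) L
    ≡⟨ cong₂ _+_ (sumList-cong (λ {p} _ → summand-cons (suc k) x p) (Π-nonempty y R))
                 (sumList-cong (summand-mergeHead k x) (Π-nonempty y R)) ⟩
  sumList (λ p → 2ℚ * t * (ι (2 ℕ.^ length p) * H k p)) L + sumList (λ p → t * summand (suc k) p) L
    ≡⟨ cong₂ _+_ (sumList-*ˡ (2ℚ * t) (λ p → ι (2 ℕ.^ length p) * H k p) L) (sumList-*ˡ t (summand (suc k)) L) ⟩
  2ℚ * t * sumList (λ p → ι (2 ℕ.^ length p) * H k p) L + t * sumList (summand (suc k)) L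
    ≡⟨ cong₂ (λ u v → 2ℚ * t * u + t * v) inner (Π-kernel y R k) ⟩
  2ℚ * t * sumTo k (kernel (y ∷ R)) + t * kernel (y ∷ R) (suc k)
    ≡⟨ factor t (sumTo k (kernel (y ∷ R))) (kernel (y ∷ R) (suc k)) ⟩
  t * (kernel (y ∷ R) (suc k) + 2ℚ * sumTo k (kernel (y ∷ R))) ∎
  where
  L = Π (y ∷ R)
  t = term x (suc k)
  inner : sumList (λ p → ι (2 ℕ.^ length p) * H k p) L ≡ sumTo k (kernel (y ∷ R))
  inner = begin
    sumList (λ p → ι (2 ℕ.^ length p) * H k p) L     ≡⟨ sumList-cong (H≡sumTo-summand k) (Π-nonempty y R) ⟩
    sumList (λ p → sumTo k (λ i → summand i p)) L    ≡⟨ sumList-sumTo k (λ p i → summand i p) L ⟩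
    sumTo k (λ i → sumList (summand i) L)            ≡⟨ sumTo-cong k (Π-kernel y R) ⟩
    sumTo k (kernel (y ∷ R))                         ∎
  factor : ∀ t s d → 2ℚ * t * s + t * d ≡ t * (d + 2ℚ * s)
  factor = solve-∀ ℚ-ring

sumΠ≡𝕋-kernel : ∀ n x R → sumΠ n (x ∷ R) ≡ 𝕋 n (kernel (x ∷ R))
sumΠ≡𝕋-kernel n x R = begin
  sumΠ n (x ∷ R)                                                 ≡⟨ sumΠ≡sumList n (x ∷ R) ⟩
  sumList (λ p → ι (2 ℕ.^ length p) * calH n p) (Π (x ∷ R))      ≡⟨ sumList-cong (λ {p} _ → weighted-calH≡𝕋 n p) (Π-nonempty x R) ⟩
  sumList (λ p → 𝕋 n (λ k → summand k p)) (Π (x ∷ R))           ≡⟨ sumList-𝕋 n (λ p k → summand k p) (Π (x ∷ R)) ⟩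
  𝕋 n (λ k → sumList (summand k) (Π (x ∷ R)))                   ≡⟨ 𝕋-cong n (Π-kernel x R) ⟩
  𝕋 n (kernel (x ∷ R))                                           ∎

-- Expanding H⋆ as a transform

infix 4 _⇝_
record _⇝_ (S : List ℤ) (D : ℕ → ℚ) : Set where
  constructor expands
  field Hstar≡-𝕋 : ∀ n → Hstar (suc n) S ≡ - 𝕋 (suc n) D
open _⇝_

⇝-resp : ∀ {S D D′} → D ≗₊ D′ → S ⇝ D → S ⇝ D′
⇝-resp D≗D′ (expands S⇝D) = expands λ n → trans (S⇝D n) (cong -_ (𝕋-cong (suc n) D≗D′))

⇝-cons : ∀ x {S D D′} → S ⇝ D → (∀ n → 𝕋 n D′ ≡ sumTo n (λ m → term x m * 𝕋 m D)) → (x ∷ S) ⇝ D′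
⇝-cons x {S} {D} {D′} (expands S⇝D) transfer = expands λ n → begin
  sumTo (suc n) (λ m → term x m * Hstar m S)       ≡⟨ sumTo-cong (suc n) (λ m → cong (term x (suc m) *_) (S⇝D m)) ⟩
  sumTo (suc n) (λ m → term x m * - 𝕋 m D)         ≡⟨ sumTo-cong (suc n) (λ m → a*-b≡-[a*b] (term x (suc m)) (𝕋 (suc m) D)) ⟩
  sumTo (suc n) (λ m → - (term x m * 𝕋 m D))       ≡⟨ sumTo-neg (suc n) (λ m → term x m * 𝕋 m D) ⟩
  - sumTo (suc n) (λ m → term x m * 𝕋 m D)         ≡⟨ cong -_ (sym (transfer (suc n))) ⟩
  - 𝕋 (suc n) D′                                   ∎
  where
  a*-b≡-[a*b] : ∀ a b → a * - b ≡ - (a * b)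
  a*-b≡-[a*b] = solve-∀ ℚ-ring

⇝-cons-2 : ∀ {S D} → S ⇝ D → (+ 2 ∷ S) ⇝ (λ k → term (+ 2) k * D k)
⇝-cons-2 {D = D} S⇝D = ⇝-cons (+ 2) S⇝D (𝕋-term2 D)

⇝-cons-1 : ∀ {S D} → S ⇝ D → (+ 1 ∷ S) ⇝ (λ k → term (+ 1) k * Λ D k)
⇝-cons-1 {D = D} S⇝D = ⇝-cons (+ 1) S⇝D (𝕋-term1 D)

⇝-cons-3+ : ∀ j {S D} → S ⇝ D → (+ (3 ℕ.+ j) ∷ S) ⇝ (λ k → term (bar 2) k * Λ (chain j D) k)
⇝-cons-3+ j {D = D} S⇝D = ⇝-cons (+ (3 ℕ.+ j)) S⇝D (𝕋-term3+ j D)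

twos-kernel : ℕ → ℕ → ℚ
twos-kernel zero    k = 2ℚ * alt k
twos-kernel (suc t) k = term (+ 2) k * twos-kernel t k

twos-⇝ : ∀ t → twos t ⇝ twos-kernel t
twos-⇝ zero      = expands λ n → cong -_ (sym (𝕋-2alt n))
twos-⇝ (suc t)   = ⇝-cons-2 (twos-⇝ t)

NonEmpty-++ : ∀ A {V : List ℤ} → NonEmpty V → NonEmpty (A ++ V)
NonEmpty-++ []      ne = ne
NonEmpty-++ (_ ∷ _) ne = λ ()

tail-factor-nonempty : ∀ {V} → NonEmpty V → tail-factor V ≡ Λ (kernel V)
tail-factor-nonempty {[]}    ne = ⊥-elim (ne refl)
tail-factor-nonempty {_ ∷ _} ne = refl

2⊕+[1+n] : ∀ n → (+ 2) ⊕ +[1+ n ] ≡ + (suc n ℕ.+ 2)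
2⊕+[1+n] n = cong₂ ℤ._+_ (ℤP.*-identityˡ +[1+ n ]) (ℤP.*-identityˡ (+ 2))

2⊕-[1+n] : ∀ n → (+ 2) ⊕ -[1+ n ] ≡ bar (suc n ℕ.+ 2)
2⊕-[1+n] n = trans (cong₂ ℤ._+_ (ℤP.*-identityˡ -[1+ n ]) (ℤP.-1*i≡-i (+ 2))) (cong -[1+_] (sym (ℕP.+-suc n 1)))

bar1⊕+[1+n] : ∀ n → bar 1 ⊕ +[1+ n ] ≡ bar (suc (suc n))
bar1⊕+[1+n] n = trans (cong₂ ℤ._+_ (ℤP.-1*i≡-i +[1+ n ]) (ℤP.*-identityˡ (bar 1))) (cong (λ m → -[1+ suc m ]) (ℕP.+-identityʳ n))

2a+1≡1+2a : ∀ a → 2 ℕ.* a ℕ.+ 1 ≡ suc (2 ℕ.* a)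
2a+1≡1+2a a = ℕP.+-comm (2 ℕ.* a) 1

2⊕odd : ∀ a → (+ 2) ⊕ (+ (2 ℕ.* a ℕ.+ 1)) ≡ + (2 ℕ.* suc a ℕ.+ 1)
2⊕odd a = begin
  (+ 2) ⊕ (+ (2 ℕ.* a ℕ.+ 1))    ≡⟨ cong (λ m → (+ 2) ⊕ (+ m)) (2a+1≡1+2a a) ⟩
  (+ 2) ⊕ +[1+ 2 ℕ.* a ]          ≡⟨ 2⊕+[1+n] (2 ℕ.* a) ⟩
  + (suc (2 ℕ.* a) ℕ.+ 2)          ≡⟨ cong +_ (index a) ⟩
  + (2 ℕ.* suc a ℕ.+ 1)            ∎
  where
  index : ∀ a → suc (2 ℕ.* a) ℕ.+ 2 ≡ 2 ℕ.* suc a ℕ.+ 1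
  index = ℕRing.solve-∀

2⊕even : ∀ b → (+ 2) ⊕ bar (2 ℕ.* b ℕ.+ 2) ≡ bar (2 ℕ.* suc b ℕ.+ 2)
2⊕even b = begin
  (+ 2) ⊕ bar (2 ℕ.* b ℕ.+ 2)      ≡⟨ cong (λ m → (+ 2) ⊕ bar m) (index₁ b) ⟩
  (+ 2) ⊕ -[1+ suc (2 ℕ.* b) ]      ≡⟨ 2⊕-[1+n] (suc (2 ℕ.* b)) ⟩
  bar (suc (suc (2 ℕ.* b)) ℕ.+ 2)   ≡⟨ cong bar (index₂ b) ⟩
  bar (2 ℕ.* suc b ℕ.+ 2)           ∎
  where
  index₁ : ∀ b → 2 ℕ.* b ℕ.+ 2 ≡ suc (suc (2 ℕ.* b))
  index₁ = ℕRing.solve-∀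
  index₂ : ∀ b → suc (suc (2 ℕ.* b)) ℕ.+ 2 ≡ 2 ℕ.* suc b ℕ.+ 2
  index₂ = ℕRing.solve-∀

bar1⊕odd : ∀ a → bar 1 ⊕ (+ (2 ℕ.* a ℕ.+ 1)) ≡ bar (2 ℕ.* a ℕ.+ 2)
bar1⊕odd a = begin
  bar 1 ⊕ (+ (2 ℕ.* a ℕ.+ 1))   ≡⟨ cong (λ m → bar 1 ⊕ (+ m)) (2a+1≡1+2a a) ⟩
  bar 1 ⊕ +[1+ 2 ℕ.* a ]         ≡⟨ bar1⊕+[1+n] (2 ℕ.* a) ⟩
  bar (suc (suc (2 ℕ.* a)))      ≡⟨ cong bar (index a) ⟩
  bar (2 ℕ.* a ℕ.+ 2)            ∎
  where
  index : ∀ a → suc (suc (2 ℕ.* a)) ≡ 2 ℕ.* a ℕ.+ 2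
  index = ℕRing.solve-∀

kernel-⊕ : ∀ x y R → kernel ((x ⊕ y) ∷ R) ≗₊ (λ k → term x k * kernel (y ∷ R) k)
kernel-⊕ x y R k = trans (cong (_* tail-factor R (suc k)) (term-⊕ x y k))
                         (ℚP.*-assoc (term x (suc k)) (term y (suc k)) (tail-factor R (suc k)))

chain-kernel-odd : ∀ a V → chain 0 (kernel (+ (2 ℕ.* a ℕ.+ 1) ∷ V)) ≗₊ kernel (bar (2 ℕ.* a ℕ.+ 2) ∷ V)
chain-kernel-odd a V k = begin
  term (bar 1) (suc k) * kernel (+ (2 ℕ.* a ℕ.+ 1) ∷ V) (suc k)  ≡⟨ sym (kernel-⊕ (bar 1) (+ (2 ℕ.* a ℕ.+ 1)) V k) ⟩
  kernel ((bar 1 ⊕ (+ (2 ℕ.* a ℕ.+ 1))) ∷ V) (suc k)               ≡⟨ cong (λ x → kernel (x ∷ V) (suc k)) (bar1⊕odd a) ⟩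
  kernel (bar (2 ℕ.* a ℕ.+ 2) ∷ V) (suc k)                         ∎

chain-twos : ∀ t → chain 0 (twos-kernel t) ≗₊ kernel (+ (2 ℕ.* t ℕ.+ 1) ∷ [])
chain-twos zero k = begin
  term (bar 1) (suc k) * (2ℚ * s)     ≡⟨ cong (_* (2ℚ * s)) (term-neg 0 k) ⟩
  s * (r * 1ℚ) * (2ℚ * s)             ≡⟨ ≡-modulo (r * 1ℚ * 2ℚ) (alt-square (suc k)) (collect s r) ⟩
  r * 1ℚ * 2ℚ                         ≡⟨ cong (_* 2ℚ) (sym (term-pos 0 k)) ⟩
  term (+ 1) (suc k) * 2ℚ             ∎
  where
  s = alt (suc k)
  r = recip (suc k)
  collect : ∀ s r → s * (r * 1ℚ) * (2ℚ * s) ≡ r * 1ℚ * 2ℚ + r * 1ℚ * 2ℚ * (s * s - 1ℚ)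
  collect = solve-∀ ℚ-ring
chain-twos (suc t) k = begin
  term (bar 1) (suc k) * (term (+ 2) (suc k) * twos-kernel t (suc k))
    ≡⟨ swap (term (bar 1) (suc k)) (term (+ 2) (suc k)) (twos-kernel t (suc k)) ⟩
  term (+ 2) (suc k) * (term (bar 1) (suc k) * twos-kernel t (suc k))
    ≡⟨ cong (term (+ 2) (suc k) *_) (chain-twos t k) ⟩
  term (+ 2) (suc k) * kernel (+ (2 ℕ.* t ℕ.+ 1) ∷ []) (suc k)
    ≡⟨ sym (kernel-⊕ (+ 2) (+ (2 ℕ.* t ℕ.+ 1)) [] k) ⟩
  kernel (((+ 2) ⊕ (+ (2 ℕ.* t ℕ.+ 1))) ∷ []) (suc k)
    ≡⟨ cong (λ x → kernel (x ∷ []) (suc k)) (2⊕odd t) ⟩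
  kernel (+ (2 ℕ.* suc t ℕ.+ 1) ∷ []) (suc k) ∎
  where
  swap : ∀ a b x → a * (b * x) ≡ b * (a * x)
  swap = solve-∀ ℚ-ring

chain-ones : ∀ j {D V} → NonEmpty V → chain 0 D ≗₊ kernel V → chain j D ≗₊ kernel (ones j ++ V)
chain-ones zero    ne chain≗ = chain≗
chain-ones (suc j) {D} {V} ne chain≗ k = cong (term (+ 1) (suc k) *_) (begin
  Λ (chain j D) (suc k)               ≡⟨ Λ-cong {chain j D} {kernel (ones j ++ V)} (chain-ones j {D} {V} ne chain≗) k ⟩
  Λ (kernel (ones j ++ V)) (suc k)    ≡⟨ cong (λ f → f (suc k)) (sym (tail-factor-nonempty {ones j ++ V} (NonEmpty-++ (ones j) ne))) ⟩
  tail-factor (ones j ++ V) (suc k)   ∎)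

⇝-kernel-2 : ∀ x R {S} → S ⇝ kernel (x ∷ R) → (+ 2 ∷ S) ⇝ kernel (((+ 2) ⊕ x) ∷ R)
⇝-kernel-2 x R S⇝ = ⇝-resp (λ k → sym (kernel-⊕ (+ 2) x R k)) (⇝-cons-2 S⇝)

⇝-twos-odd : ∀ a V {S} → S ⇝ kernel (+ 1 ∷ V) → (twos a ++ S) ⇝ kernel (+ (2 ℕ.* a ℕ.+ 1) ∷ V)
⇝-twos-odd zero    V S⇝ = S⇝
⇝-twos-odd (suc a) V {S} S⇝ =
  subst (λ x → twos (suc a) ++ S ⇝ kernel (x ∷ V)) (2⊕odd a) (⇝-kernel-2 (+ (2 ℕ.* a ℕ.+ 1)) V (⇝-twos-odd a V S⇝))

⇝-twos-even : ∀ b V {S} → S ⇝ kernel (bar 2 ∷ V) → (twos b ++ S) ⇝ kernel (bar (2 ℕ.* b ℕ.+ 2) ∷ V)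
⇝-twos-even zero    V S⇝ = S⇝
⇝-twos-even (suc b) V {S} S⇝ =
  subst (λ x → twos (suc b) ++ S ⇝ kernel (x ∷ V)) (2⊕even b) (⇝-kernel-2 (bar (2 ℕ.* b ℕ.+ 2)) V (⇝-twos-even b V S⇝))

⇝-twos-1 : ∀ a V {S} → NonEmpty V → S ⇝ kernel V → (twos a ++ + 1 ∷ S) ⇝ kernel (+ (2 ℕ.* a ℕ.+ 1) ∷ V)
⇝-twos-1 a []      ne S⇝ = ⊥-elim (ne refl)
⇝-twos-1 a V@(_ ∷ _) ne S⇝ = ⇝-twos-odd a V (⇝-cons-1 S⇝)

⇝-twos-c : ∀ b c V {S D} → 3 ≤ c → NonEmpty V → S ⇝ D → chain 0 D ≗₊ kernel V →
           (twos b ++ + c ∷ S) ⇝ kernel (bar (2 ℕ.* b ℕ.+ 2) ∷ ones (c ∸ 3) ++ V)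
⇝-twos-c b (suc (suc (suc j))) V {S} {D} (s≤s (s≤s (s≤s _))) ne S⇝ chain≗ =
  ⇝-twos-even b (ones j ++ V) (⇝-resp (λ k → cong (term (bar 2) (suc k) *_) (kernel-tail k)) (⇝-cons-3+ j S⇝))
  where
  kernel-tail : Λ (chain j D) ≗₊ tail-factor (ones j ++ V)
  kernel-tail k = trans (Λ-cong {chain j D} {kernel (ones j ++ V)} (chain-ones j {D} {V} ne chain≗) k)
                        (cong (λ f → f (suc k)) (sym (tail-factor-nonempty {ones j ++ V} (NonEmpty-++ (ones j) ne))))

-- The two families of strings

module _ (t : ℕ) (a b c : ℕ → ℕ) (3≤c : (j : ℕ) → 1 ≤ j → 3 ≤ c j) where

  ⇝-blocksII : ∀ r {U V} → NonEmpty V → U ⇝ kernel V →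
    (blocks r (λ j → twos (b j) ++ (+ c j) ∷ twos (a j) ++ (+ 1) ∷ []) ++ U) ⇝
    kernel (blocks r (λ j → bar (2 ℕ.* b j ℕ.+ 2) ∷ ones (c j ∸ 3) ++ bar (2 ℕ.* a j ℕ.+ 2) ∷ []) ++ V)
  ⇝-blocksII zero    ne U⇝ = U⇝
  ⇝-blocksII (suc r) {U} {V} ne U⇝ =
    subst₂ (λ S Q → S ⇝ kernel Q)
      (sym (ListP.++-assoc (blocks r F) (F (suc r)) U)) (sym (ListP.++-assoc (blocks r G) (G (suc r)) V))
      (⇝-blocksII r (NonEmpty-++ (G (suc r)) ne) (subst₂ (λ S Q → S ⇝ kernel Q) (sym assocS) (sym assocQ) block))
    where
    F = λ j → twos (b j) ++ (+ c j) ∷ twos (a j) ++ (+ 1) ∷ []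
    G = λ j → bar (2 ℕ.* b j ℕ.+ 2) ∷ ones (c j ∸ 3) ++ bar (2 ℕ.* a j ℕ.+ 2) ∷ []
    aⱼ = a (suc r)
    bⱼ = b (suc r)
    cⱼ = c (suc r)
    block : (twos bⱼ ++ + cⱼ ∷ twos aⱼ ++ + 1 ∷ U) ⇝ kernel (bar (2 ℕ.* bⱼ ℕ.+ 2) ∷ ones (cⱼ ∸ 3) ++ bar (2 ℕ.* aⱼ ℕ.+ 2) ∷ V)
    block = ⇝-twos-c bⱼ cⱼ (bar (2 ℕ.* aⱼ ℕ.+ 2) ∷ V) (3≤c (suc r) z<s) (λ ())
              (⇝-twos-1 aⱼ V ne U⇝) (chain-kernel-odd aⱼ V)
    assocS : F (suc r) ++ U ≡ twos bⱼ ++ + cⱼ ∷ twos aⱼ ++ + 1 ∷ U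
    assocS = trans (ListP.++-assoc (twos bⱼ) (+ cⱼ ∷ twos aⱼ ++ + 1 ∷ []) U)
                   (cong (λ L → twos bⱼ ++ + cⱼ ∷ L) (ListP.++-assoc (twos aⱼ) (+ 1 ∷ []) U))
    assocQ : G (suc r) ++ V ≡ bar (2 ℕ.* bⱼ ℕ.+ 2) ∷ ones (cⱼ ∸ 3) ++ bar (2 ℕ.* aⱼ ℕ.+ 2) ∷ V
    assocQ = cong (bar (2 ℕ.* bⱼ ℕ.+ 2) ∷_) (ListP.++-assoc (ones (cⱼ ∸ 3)) (bar (2 ℕ.* aⱼ ℕ.+ 2) ∷ []) V)

  ⇝-sII : ∀ r → sII r t a b c ⇝ kernel (πII r t a b c)
  ⇝-sII r = ⇝-blocksII r (λ ()) (⇝-twos-c (b (suc r)) (c (suc r)) (+ (2 ℕ.* t ℕ.+ 1) ∷ []) (3≤c (suc r) z<s) (λ ())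
                                   (twos-⇝ t) (chain-twos t))

  ⇝-blockI : ∀ j {U D Z} → NonEmpty Z → U ⇝ D → chain 0 D ≗₊ kernel Z →
    ((twos (a (suc j)) ++ (+ 1) ∷ twos (b (suc j)) ++ (+ c (suc j)) ∷ []) ++ U) ⇝
    kernel (+ (2 ℕ.* a (suc j) ℕ.+ 1) ∷ bar (2 ℕ.* b (suc j) ℕ.+ 2) ∷ ones (c (suc j) ∸ 3) ++ Z)
  ⇝-blockI j {U} {D} {Z} ne U⇝ chain≗ =
    subst (λ S → S ⇝ kernel (+ (2 ℕ.* aⱼ ℕ.+ 1) ∷ bar (2 ℕ.* bⱼ ℕ.+ 2) ∷ ones (cⱼ ∸ 3) ++ Z)) (sym assocS)
    (⇝-twos-1 aⱼ (bar (2 ℕ.* bⱼ ℕ.+ 2) ∷ ones (cⱼ ∸ 3) ++ Z) (λ ())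
      (⇝-twos-c bⱼ cⱼ Z (3≤c (suc j) z<s) ne U⇝ chain≗))
    where
    aⱼ = a (suc j)
    bⱼ = b (suc j)
    cⱼ = c (suc j)
    assocS : (twos aⱼ ++ + 1 ∷ twos bⱼ ++ + cⱼ ∷ []) ++ U ≡ twos aⱼ ++ + 1 ∷ twos bⱼ ++ + cⱼ ∷ U
    assocS = trans (ListP.++-assoc (twos aⱼ) (+ 1 ∷ twos bⱼ ++ + cⱼ ∷ []) U)
                   (cong (λ L → twos aⱼ ++ + 1 ∷ L) (ListP.++-assoc (twos bⱼ) (+ cⱼ ∷ []) U))

  -- The head 2a_j+1 of every block but the first is merged with the -1 produced by c_(j-1).
  ⇝-blocksI : ∀ r {U D Z} → NonEmpty Z → U ⇝ D → chain 0 D ≗₊ kernel Z →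
    (blocks (suc r) (λ j → twos (a j) ++ (+ 1) ∷ twos (b j) ++ (+ c j) ∷ []) ++ U) ⇝
    kernel (blocks (suc r) (λ j → (if j ℕ.≡ᵇ 1 then + (2 ℕ.* a j ℕ.+ 1) else bar (2 ℕ.* a j ℕ.+ 2))
                                   ∷ bar (2 ℕ.* b j ℕ.+ 2) ∷ ones (c j ∸ 3)) ++ Z)
  ⇝-blocksI zero    ne U⇝ chain≗ = ⇝-blockI 0 ne U⇝ chain≗
  ⇝-blocksI (suc r) {U} {D} {Z} ne U⇝ chain≗ =
    subst₂ (λ S Q → S ⇝ kernel Q)
      (sym (ListP.++-assoc (blocks (suc r) F) (F (suc (suc r))) U)) (sym (ListP.++-assoc (blocks (suc r) G) (G (suc (suc r))) Z))
      (⇝-blocksI r (λ ()) (⇝-blockI (suc r) ne U⇝ chain≗)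
        (chain-kernel-odd (a (suc (suc r))) (bar (2 ℕ.* b (suc (suc r)) ℕ.+ 2) ∷ ones (c (suc (suc r)) ∸ 3) ++ Z)))
    where
    F = λ j → twos (a j) ++ (+ 1) ∷ twos (b j) ++ (+ c j) ∷ []
    G = λ j → (if j ℕ.≡ᵇ 1 then + (2 ℕ.* a j ℕ.+ 1) else bar (2 ℕ.* a j ℕ.+ 2)) ∷ bar (2 ℕ.* b j ℕ.+ 2) ∷ ones (c j ∸ 3)

  ⇝-sI : ∀ r → sI (suc r) t a b c ⇝ kernel (πI (suc r) t a b c)
  ⇝-sI r = ⇝-blocksI r (λ ()) (twos-⇝ t) (chain-twos t)

⇝-sumΠ : ∀ {S Q} → NonEmpty Q → S ⇝ kernel Q → ∀ n → Hstar (suc n) S ≡ - sumΠ (suc n) Q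
⇝-sumΠ {Q = []}    ne S⇝ n = ⊥-elim (ne refl)
⇝-sumΠ {Q = x ∷ R} ne S⇝ n = trans (Hstar≡-𝕋 S⇝ n) (cong -_ (sym (sumΠ≡𝕋-kernel (suc n) x R)))

theorem7p1 : (r t : ℕ) → 1 ≤ r → (a b c : ℕ → ℕ) → ((j : ℕ) → 1 ≤ j → 3 ≤ c j) →
    (n : ℕ) → 1 ≤ n →
    (Hstar n (sI r t a b c) ≡ - sumΠ n (πI r t a b c))
    × (Hstar n (sII r t a b c) ≡ - sumΠ n (πII r t a b c))
theorem7p1 (suc r) t (s≤s z≤n) a b c 3≤c (suc n) (s≤s z≤n) =
    ⇝-sumΠ (NonEmpty-++ (blocks (suc r) _) (λ ())) (⇝-sI t a b c 3≤c r) n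
  , ⇝-sumΠ (NonEmpty-++ (blocks (suc r) _) (λ ())) (⇝-sII t a b c 3≤c (suc r)) n
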